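{- For any $n \geq 2$, $sat(K_3^n,C_4) = 3n$. Moreover, writing the parts of $K_3^n$ as $V_1,V_2,V_3$, a spanning subgraph $H$ of $K_3^n$ is $C_4$-saturated relative to $K_3^n$ with exactly $3n$ edges if and only if $H$ has the following form: there are vertices $x_1\in V_1$, $x_2\in V_2$, $x_3\in V_3$ forming a triangle, and there is a bijection $\sigma:[3]\to[3]$ with $\sigma(i)\neq i$ for all $i$ such that every vertex of $V_i\setminus\{x_i\}$ has degree $1$ in $H$ with unique neighbour $x_{\sigma(i)}$, for each $i\in[3]$ (i.e. $H\in\Omega^{(4,3,n)}$).
   Context: All graphs are finite, simple and undirected. $K_k^n$ denotes the complete $k$-partite graph with exactly $n$ vertices in each of its $k$ parts. $C_4$ is the cycle on $4$ vertices. For graphs $G$ and $F$, a spanning subgraph $H$ of $G$ is $F$-saturated relative to $G$ if $H$ contains no copy of $F$ but $H+e$ contains a copy of $F$ for every $e\in E(G)\setminus E(H)$; $sat(G,F)$ is the minimum number of edges of a graph that is $F$-saturated relative to $G$. $\Omega^{(4,3,n)}$ denotes the family of graphs described in the claim (all of which are isomorphic). -}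

module Defs where

open import Data.Nat.Base using (ℕ; _+_; ⌊_/2⌋)
open import Data.Fin.Base using (Fin)
open import Data.Bool.Base using (Bool; true; false; if_then_else_; _∨_; _∧_)
open import Data.Product using (_×_; _,_; proj₁; Σ; ∃; ∃-syntax)
open import Data.List.Base using (List; allFin; cartesianProduct; map)
open import Data.Nat.ListAction using (sum)
open import Relation.Binary.PropositionalEquality using (_≡_; _≢_)
open import Relation.Nullary.Decidable using (⌊_⌋)
open import Data.Product.Properties using (≡-dec)
open import Data.Fin.Properties using (_≟_)
open import Function.Definitions using (Bijective)
open import Function.Bundles using (_⇔_)

-- Vertices of K_3^n: (part i, index j), part i ∈ Fin 3 is V_{i+1}.
Vtx : ℕ → Set
Vtx n = Fin 3 × Fin n

part : ∀ {n} → Vtx n → Fin 3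
part = proj₁

-- A spanning subgraph of K_3^n (simple, undirected): symmetric boolean adjacency
-- whose edges all join different parts (hence it is also loopless).
record SubK3 (n : ℕ) : Set where
  field
    adj   : Vtx n → Vtx n → Bool
    sym   : ∀ u v → adj u v ≡ adj v u
    inK   : ∀ u v → adj u v ≡ true → part u ≢ part v
open SubK3 public

vertices : (n : ℕ) → List (Vtx n)
vertices n = cartesianProduct (allFin 3) (allFin n)

-- number of ordered adjacent pairs (= twice the number of edges)
orderedEdges : ∀ {n} → SubK3 n → ℕ
orderedEdges {n} H =
  sum (map (λ u → sum (map (λ v → if adj H u v then 1 else 0) (vertices n))) (vertices n))

edges : ∀ {n} → SubK3 n → ℕ
edges H = ⌊ orderedEdges H /2⌋

HasC4 : ∀ {n} → (Vtx n → Vtx n → Bool) → Set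
HasC4 {n} a = ∃[ p ] ∃[ q ] ∃[ r ] ∃[ s ]
  ( (p ≢ q) × (p ≢ r) × (p ≢ s) × (q ≢ r) × (q ≢ s) × (r ≢ s)
  × a p q ≡ true × a q r ≡ true × a r s ≡ true × a s p ≡ true )

_≟V_ : ∀ {n} → (u v : Vtx n) → _
_≟V_ = ≡-dec _≟_ _≟_

addEdge : ∀ {n} → (Vtx n → Vtx n → Bool) → Vtx n → Vtx n → Vtx n → Vtx n → Bool
addEdge a u v x y =
  a x y ∨ ((⌊ x ≟V u ⌋ ∧ ⌊ y ≟V v ⌋) ∨ (⌊ x ≟V v ⌋ ∧ ⌊ y ≟V u ⌋))


C4Saturated : ∀ {n} → SubK3 n → Set
C4Saturated {n} H =
  (HasC4 (adj H) → Data.Empty.⊥)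
  × (∀ (u v : Vtx n) → part u ≢ part v → adj H u v ≡ false → HasC4 (addEdge (adj H) u v))
  where import Data.Empty

InOmega : ∀ {n} → SubK3 n → Set
InOmega {n} H =
  Σ (Fin 3 → Fin n) λ x → Σ (Fin 3 → Fin 3) λ σ →
    Bijective _≡_ _≡_ σ × (∀ i → σ i ≢ i)
    × (∀ i j → i ≢ j → adj H (i , x i) (j , x j) ≡ true)
    × (∀ i (v : Fin n) → v ≢ x i → ∀ w →
         (adj H (i , v) w ≡ true) ⇔ (w ≡ (σ i , x (σ i))))

module Submission where

-- Discharging. Every edge carries charge 2, which goes entirely to an endpoint of degree 1 (a
-- leaf) and is split evenly otherwise. In a C₄-saturated H no two leaves are adjacent and every
-- non-leaf has two non-leaf neighbours: were b the only one of the neighbour w of a leaf v, b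
-- would reach every vertex y of the part avoided by v and w, and the paths w b c y saturating
-- the non-edges wy would inject that part into the part of w minus w. Hence every vertex
-- receives at least 2, and 2|E(H)| ≥ 2·3n.
--
-- With equality every non-leaf has exactly two non-leaf neighbours. Without leaves H is
-- 2-regular and the at most four vertices reached from (0,0) by paths of length 1 or 3 cannot
-- saturate all 2n non-edges into the other parts. Otherwise the two non-leaf neighbours of the
-- neighbour of a leaf form, with it, a triangle meeting every part once, all other vertices
-- are leaves attached to it, and leaves of different parts have different neighbours: this is
-- Ω. Conversely, in Ω a 4-cycle would need four triangle vertices, and every non-edge closes a
-- 4-cycle through the triangle.

open import Data.Bool.Base using (Bool; true; false; if_then_else_; not; _∧_)
open import Data.Bool.Properties using (∨-zeroʳ) renaming (_≟_ to _≟B_)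
open import Data.Empty using (⊥; ⊥-elim)
open import Data.Fin.Base using (Fin; zero; suc; punchOut; splitAt; join)
open import Data.Fin.Properties
  using (all?; any?; <-cmp; <-asym; injective⇒≤; join-splitAt; punchOut-injective)
  renaming (_≟_ to _≟F_; _<?_ to _<F?_)
open import Data.List.Base using (List; []; _∷_; map; length; lookup; allFin; cartesianProduct)
open import Data.List.Membership.Propositional using (_∈_)
open import Data.List.Membership.Propositional.Properties using (∈-cartesianProduct⁺; ∈-allFin)
open import Data.List.Properties using (length-++; length-map; length-tabulate)
open import Data.List.Relation.Unary.All as All using (All; []; _∷_)
open import Data.List.Relation.Unary.AllPairs using ([]; _∷_)
open import Data.List.Relation.Unary.Any using (here; there; index)
open import Data.List.Relation.Unary.Any.Properties using (lookup-index)
open import Data.List.Relation.Unary.Unique.Propositional using (Unique)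
open import Data.List.Relation.Unary.Unique.Propositional.Properties using (allFin⁺; cartesianProduct⁺)
open import Data.Nat.Base
open import Data.Nat.ListAction using (sum)
open import Data.Nat.Properties
  using (_≟_; +-commutativeSemigroup; +-assoc; +-identityʳ; *-zeroʳ; *-suc; *-distribˡ-+; ≤-reflexive; ≤-trans;
         ≤-antisym; +-mono-≤; +-monoˡ-≤; +-monoʳ-≤; +-cancelˡ-≤; +-cancelʳ-≤; *-cancelˡ-≤; *-cancelˡ-≡;
         n≮n; n≡⌊n+n/2⌋; module ≤-Reasoning)
open import Algebra.Properties.CommutativeSemigroup +-commutativeSemigroup
  using () renaming (interchange to +-interchange)
open import Data.Product using (_×_; _,_; proj₁; proj₂; ∃; ∃₂; ∃-syntax)
open import Data.Sum using (_⊎_; inj₁; inj₂; swap)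
open import Data.Unit using (tt)
open import Defs hiding (sym)
open import Function.Bundles using (_⇔_; mk⇔; Equivalence)
open import Function.Definitions using (Injective; Bijective)
open import Level using (0ℓ)
open import Relation.Binary.Definitions using (DecidableEquality; tri<; tri≈; tri>)
open import Relation.Binary.PropositionalEquality
open import Relation.Nullary using (Dec; yes; no; ¬_; ¬?; _×-dec_; _⊎-dec_; contradiction)
open import Relation.Nullary.Decidable using (⌊_⌋; toWitness; decidable-stable)
open import Relation.Unary using (Pred; Decidable)

𝟙 : Bool → ℕ
𝟙 b = if b then 1 else 0

module _ {A : Set} where

  ∑ : List A → (A → ℕ) → ℕ
  ∑ xs f = sum (map f xs)

  ∑-cong : ∀ xs {f g : A → ℕ} → (∀ x → f x ≡ g x) → ∑ xs f ≡ ∑ xs g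
  ∑-cong []       f≡g = refl
  ∑-cong (x ∷ xs) f≡g = cong₂ _+_ (f≡g x) (∑-cong xs f≡g)

  ∑-mono-≤ : ∀ xs {f g : A → ℕ} → (∀ x → f x ≤ g x) → ∑ xs f ≤ ∑ xs g
  ∑-mono-≤ []       f≤g = z≤n
  ∑-mono-≤ (x ∷ xs) f≤g = +-mono-≤ (f≤g x) (∑-mono-≤ xs f≤g)

  ∑-+ : ∀ xs (f g : A → ℕ) → ∑ xs (λ x → f x + g x) ≡ ∑ xs f + ∑ xs g
  ∑-+ []       f g = refl
  ∑-+ (x ∷ xs) f g = trans (cong (f x + g x +_) (∑-+ xs f g)) (+-interchange (f x) (g x) (∑ xs f) (∑ xs g))

  ∑-*ˡ : ∀ xs c (f : A → ℕ) → ∑ xs (λ x → c * f x) ≡ c * ∑ xs f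
  ∑-*ˡ []       c f = sym (*-zeroʳ c)
  ∑-*ˡ (x ∷ xs) c f = trans (cong (c * f x +_) (∑-*ˡ xs c f)) (sym (*-distribˡ-+ c (f x) _))

  ∑-const : ∀ xs c → ∑ xs (λ _ → c) ≡ c * length xs
  ∑-const []       c = sym (*-zeroʳ c)
  ∑-const (x ∷ xs) c = trans (cong (c +_) (∑-const xs c)) (sym (*-suc c (length xs)))

  ∑-≥ : ∀ xs k (f : A → ℕ) → (∀ x → k ≤ f x) → k * length xs ≤ ∑ xs f
  ∑-≥ xs k f k≤f = subst (_≤ ∑ xs f) (∑-const xs k) (∑-mono-≤ xs k≤f)

  ∑-tight : ∀ xs k (f : A → ℕ) → (∀ x → k ≤ f x) → ∑ xs f ≤ k * length xs →
            ∀ {x} → x ∈ xs → f x ≡ k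
  ∑-tight (y ∷ ys) k f k≤f ∑≤ (here refl) = ≤-antisym fy≤k (k≤f y)
    where
    fy≤k : f y ≤ k
    fy≤k = +-cancelʳ-≤ (∑ ys f) (f y) k (begin
      f y + ∑ ys f     ≤⟨ ∑≤ ⟩
      k * suc (length ys) ≡⟨ *-suc k (length ys) ⟩
      k + k * length ys ≤⟨ +-monoʳ-≤ k (∑-≥ ys k f k≤f) ⟩
      k + ∑ ys f        ∎)
      where open ≤-Reasoning
  ∑-tight (y ∷ ys) k f k≤f ∑≤ (there x∈) = ∑-tight ys k f k≤f ∑ys≤ x∈
    where
    ∑ys≤ : ∑ ys f ≤ k * length ys
    ∑ys≤ = +-cancelˡ-≤ k (∑ ys f) (k * length ys) (begin
      k + ∑ ys f          ≤⟨ +-monoˡ-≤ (∑ ys f) (k≤f y) ⟩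
      f y + ∑ ys f        ≤⟨ ∑≤ ⟩
      k * suc (length ys) ≡⟨ *-suc k (length ys) ⟩
      k + k * length ys   ∎)
      where open ≤-Reasoning

∑-swap : ∀ {A B : Set} xs ys (f : A → B → ℕ) →
         ∑ xs (λ x → ∑ ys (f x)) ≡ ∑ ys (λ y → ∑ xs (λ x → f x y))
∑-swap []       ys f = sym (∑-const ys 0)
∑-swap (x ∷ xs) ys f = trans (cong (∑ ys (f x) +_) (∑-swap xs ys f))
                             (sym (∑-+ ys (f x) (λ y → ∑ xs (λ x → f x y))))

module PointMass {A : Set} (_≟_ : DecidableEquality A) where

  at : A → (A → ℕ) → A → ℕ
  at a f w = if ⌊ w ≟ a ⌋ then f w else 0

  at-self : ∀ a f → at a f a ≡ f a
  at-self a f with a ≟ a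
  ... | yes _  = refl
  ... | no a≢a = ⊥-elim (a≢a refl)

  at-other : ∀ {a w} f → w ≢ a → at a f w ≡ 0
  at-other {a} {w} f w≢a with w ≟ a
  ... | yes w≡a = ⊥-elim (w≢a w≡a)
  ... | no _    = refl

  ∑-at-∉ : ∀ {a} f xs → All (a ≢_) xs → ∑ xs (at a f) ≡ 0
  ∑-at-∉ f []       []         = refl
  ∑-at-∉ f (x ∷ xs) (a≢x ∷ ps) = trans (cong (_+ ∑ xs _) (at-other f (≢-sym a≢x))) (∑-at-∉ f xs ps)

  ∑-at : ∀ {a} f xs → Unique xs → a ∈ xs → ∑ xs (at a f) ≡ f a
  ∑-at {a} f (x ∷ xs) (a∉xs ∷ _) (here refl) =
    trans (cong₂ _+_ (at-self a f) (∑-at-∉ f xs a∉xs)) (+-identityʳ (f a))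
  ∑-at {a} f (x ∷ xs) (x∉xs ∷ u) (there a∈) =
    trans (cong (_+ ∑ xs _) (at-other f (All.lookup x∉xs a∈))) (∑-at f xs u a∈)

  -- At most one point of a duplicate-free list is w.
  ∑-at-unique-≤ : ∀ f ps → Unique ps → ∀ w → ∑ ps (λ p → at p f w) ≤ f w
  ∑-at-unique-≤ f []       _            w = z≤n
  ∑-at-unique-≤ f (p ∷ ps) (p∉ps ∷ u) w with w ≟ p
  ... | no _     = ∑-at-unique-≤ f ps u w
  ... | yes refl = ≤-reflexive (trans (cong (f w +_) (∑-at-∉-pt ps p∉ps)) (+-identityʳ (f w)))
    where
    ∑-at-∉-pt : ∀ qs → All (w ≢_) qs → ∑ qs (λ q → at q f w) ≡ 0
    ∑-at-∉-pt []       []          = refl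
    ∑-at-∉-pt (q ∷ qs) (w≢q ∷ ws)  = trans (cong (_+ _) (at-other f w≢q)) (∑-at-∉-pt qs ws)

  ∑-sub-≤ : ∀ f {xs} ps → Unique xs → Unique ps → (∀ p → p ∈ xs) → ∑ ps f ≤ ∑ xs f
  ∑-sub-≤ f {xs} ps uxs ups all∈ = begin
    ∑ ps f                                   ≡⟨ ∑-cong ps (λ p → ∑-at f xs uxs (all∈ p)) ⟨
    ∑ ps (λ p → ∑ xs (at p f))               ≡⟨ ∑-swap ps xs (λ p → at p f) ⟩
    ∑ xs (λ w → ∑ ps (λ p → at p f w))       ≤⟨ ∑-mono-≤ xs (∑-at-unique-≤ f ps ups) ⟩
    ∑ xs f                                   ∎
    where open ≤-Reasoning

-- Both facts are decided by evaluation over all of Fin 3; opacity keeps that evaluation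
-- from being replayed at every use.
opaque
  Fin3-pigeonhole : ∀ (i j k l : Fin 3) → i ≡ j ⊎ i ≡ k ⊎ i ≡ l ⊎ j ≡ k ⊎ j ≡ l ⊎ k ≡ l
  Fin3-pigeonhole = toWitness {a? = all? λ i → all? λ j → all? λ k → all? λ l →
    i ≟F j ⊎-dec i ≟F k ⊎-dec i ≟F l ⊎-dec j ≟F k ⊎-dec j ≟F l ⊎-dec k ≟F l} tt

  Fin3-avoid₂ : ∀ (i j : Fin 3) → ∃[ k ] i ≢ k × j ≢ k
  Fin3-avoid₂ = toWitness {a? = all? λ i → all? λ j → any? λ k → ¬? (i ≟F k) ×-dec ¬? (j ≟F k)} tt

Fin3-third-unique : ∀ {i j k l : Fin 3} → i ≢ j → i ≢ k → j ≢ k → l ≢ i → l ≢ j → l ≡ k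
Fin3-third-unique {i} {j} {k} {l} i≢j i≢k j≢k l≢i l≢j with Fin3-pigeonhole i j k l
... | inj₁ i≡j                                   = contradiction i≡j i≢j
... | inj₂ (inj₁ i≡k)                            = contradiction i≡k i≢k
... | inj₂ (inj₂ (inj₁ i≡l))                     = contradiction (sym i≡l) l≢i
... | inj₂ (inj₂ (inj₂ (inj₁ j≡k)))              = contradiction j≡k j≢k
... | inj₂ (inj₂ (inj₂ (inj₂ (inj₁ j≡l))))       = contradiction (sym j≡l) l≢j
... | inj₂ (inj₂ (inj₂ (inj₂ (inj₂ k≡l))))       = sym k≡l

Fin3-injective⇒surjective : ∀ {σ : Fin 3 → Fin 3} → Injective _≡_ _≡_ σ → ∀ y → ∃[ i ] σ i ≡ y
Fin3-injective⇒surjective {σ} inj y with Fin3-pigeonhole (σ zero) (σ (suc zero)) (σ (suc (suc zero))) y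
... | inj₁ σ0≡σ1                                 = contradiction (inj σ0≡σ1) λ ()
... | inj₂ (inj₁ σ0≡σ2)                          = contradiction (inj σ0≡σ2) λ ()
... | inj₂ (inj₂ (inj₁ σ0≡y))                    = zero , σ0≡y
... | inj₂ (inj₂ (inj₂ (inj₁ σ1≡σ2)))            = contradiction (inj σ1≡σ2) λ ()
... | inj₂ (inj₂ (inj₂ (inj₂ (inj₁ σ1≡y))))      = suc zero , σ1≡y
... | inj₂ (inj₂ (inj₂ (inj₂ (inj₂ σ2≡y))))      = suc (suc zero) , σ2≡y

Fin3-injective⇒bijective : ∀ {σ : Fin 3 → Fin 3} → Injective _≡_ _≡_ σ → Bijective _≡_ _≡_ σ
Fin3-injective⇒bijective inj = inj , λ y → let (i , σi≡y) = Fin3-injective⇒surjective inj y in i , λ { refl → σi≡y }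

next : Fin 3 → Fin 3
next zero             = suc zero
next (suc zero)       = suc (suc zero)
next (suc (suc zero)) = zero

next-≢ : ∀ i → i ≢ next i
next-≢ zero             ()
next-≢ (suc zero)       ()
next-≢ (suc (suc zero)) ()

next²-≢ : ∀ i → i ≢ next (next i)
next²-≢ zero             ()
next²-≢ (suc zero)       ()
next²-≢ (suc (suc zero)) ()

next³≡id : ∀ i → next (next (next i)) ≡ i
next³≡id zero             = refl
next³≡id (suc zero)       = refl
next³≡id (suc (suc zero)) = refl

next-injective : Injective _≡_ _≡_ next
next-injective {i} {j} next-i≡next-j =
  trans (sym (next³≡id i)) (trans (cong (λ k → next (next k)) next-i≡next-j) (next³≡id j))

Fin3-others : ∀ i l → l ≢ i → l ≡ next i ⊎ l ≡ next (next i)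
Fin3-others i l l≢i with l ≟F next i
... | yes l≡next  = inj₁ l≡next
... | no l≢next   = inj₂ (Fin3-third-unique (next-≢ i) (next²-≢ i) (next-≢ (next i)) l≢i l≢next)

∑∑-symmetrize : ∀ {A : Set} xs (h a : A → A → ℕ) → (∀ u w → h u w + h w u ≡ 2 * a u w) →
                ∑ xs (λ u → ∑ xs (h u)) ≡ ∑ xs (λ u → ∑ xs (a u))
∑∑-symmetrize {A} xs h a h+hᵀ≡2a = *-cancelˡ-≡ _ _ 2 (begin
  2 * ∑∑ h                                            ≡⟨ cong (∑∑ h +_) (+-identityʳ (∑∑ h)) ⟩
  ∑∑ h + ∑∑ h                                         ≡⟨ cong (∑∑ h +_) (∑-swap xs xs h) ⟩
  ∑∑ h + ∑ xs (λ u → ∑ xs (λ w → h w u))              ≡⟨ ∑-+ xs (λ u → ∑ xs (h u)) _ ⟨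
  ∑ xs (λ u → ∑ xs (h u) + ∑ xs (λ w → h w u))        ≡⟨ ∑-cong xs (λ u → ∑-+ xs (h u) (λ w → h w u)) ⟨
  ∑ xs (λ u → ∑ xs (λ w → h u w + h w u))             ≡⟨ ∑-cong xs (λ u → ∑-cong xs (h+hᵀ≡2a u)) ⟩
  ∑ xs (λ u → ∑ xs (λ w → 2 * a u w))                 ≡⟨ ∑-cong xs (λ u → ∑-*ˡ xs 2 (a u)) ⟩
  ∑ xs (λ u → 2 * ∑ xs (a u))                         ≡⟨ ∑-*ˡ xs 2 (λ u → ∑ xs (a u)) ⟩
  2 * ∑∑ a                                            ∎)
  where
  open ≡-Reasoning
  ∑∑ : (A → A → ℕ) → ℕ
  ∑∑ f = ∑ xs (λ u → ∑ xs (f u))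

𝟙<-split : ∀ {k} {i j : Fin k} → i ≢ j → 𝟙 ⌊ i <F? j ⌋ + 𝟙 ⌊ j <F? i ⌋ ≡ 1
𝟙<-split {i = i} {j} i≢j with i <F? j | j <F? i
... | yes _   | no _    = refl
... | no _    | yes _   = refl
... | yes i<j | yes j<i = contradiction j<i (<-asym i<j)
... | no i≮j  | no j≮i  with <-cmp i j
...   | tri< i<j _ _ = contradiction i<j i≮j
...   | tri≈ _ i≡j _ = contradiction i≡j i≢j
...   | tri> _ _ j<i = contradiction j<i j≮i

length-cartesianProduct : ∀ {A B : Set} (xs : List A) (ys : List B) →
                          length (cartesianProduct xs ys) ≡ length xs * length ys
length-cartesianProduct []       ys = refl
length-cartesianProduct (x ∷ xs) ys =
  trans (length-++ (map (x ,_) ys)) (cong₂ _+_ (length-map (x ,_) ys) (length-cartesianProduct xs ys))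

length-vertices : ∀ n → length (vertices n) ≡ 3 * n
length-vertices n = trans (length-cartesianProduct (allFin 3) (allFin n))
                          (cong (3 *_) (length-tabulate {n = n} (λ i → i)))

module _ {n : ℕ} where

  vertices-unique : Unique (vertices n)
  vertices-unique = cartesianProduct⁺ (allFin⁺ 3) (allFin⁺ n)

  ∈-vertices : ∀ (v : Vtx n) → v ∈ vertices n
  ∈-vertices (i , j) = ∈-cartesianProduct⁺ (∈-allFin i) (∈-allFin j)

  any-vertex? : {P : Pred (Vtx n) 0ℓ} → Decidable P → Dec (∃ P)
  any-vertex? P? with any? (λ i → any? (λ j → P? (i , j)))
  ... | yes (i , j , p) = yes ((i , j) , p)
  ... | no ¬p           = no (λ { ((i , j) , p) → ¬p (i , j , p) })

module Graph {n : ℕ} (H : SubK3 n) where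

  infix 4 _~_
  _~_ : Vtx n → Vtx n → Set
  u ~ w = adj H u w ≡ true

  ~-sym : ∀ {u w} → u ~ w → w ~ u
  ~-sym {u} {w} u~w = trans (SubK3.sym H w u) u~w

  ~-part : ∀ {u w} → u ~ w → part u ≢ part w
  ~-part {u} {w} = inK H u w

  ~-irrefl : ∀ {u w} → u ~ w → u ≢ w
  ~-irrefl u~w refl = ~-part u~w refl

  ∑V : (Vtx n → ℕ) → ℕ
  ∑V = ∑ (vertices n)

  ∑V-sub-≤ : ∀ f ps → Unique ps → ∑ ps f ≤ ∑V f
  ∑V-sub-≤ f ps ups = PointMass.∑-sub-≤ _≟V_ f ps vertices-unique ups ∈-vertices

  ∑V-at : ∀ a f → ∑V (PointMass.at _≟V_ a f) ≡ f a
  ∑V-at a f = PointMass.∑-at _≟V_ f (vertices n) vertices-unique (∈-vertices a)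

  -- Each edge is counted once, from its lower to its higher part; so orderedEdges is even.
  upEdges : ℕ
  upEdges = ∑V (λ u → ∑V (λ w → 𝟙 (adj H u w ∧ ⌊ part u <F? part w ⌋)))

  ∑∑-edge-split : (h : Vtx n → Vtx n → ℕ) → (∀ u w → h u w + h w u ≡ 2 * 𝟙 (adj H u w)) →
                  ∑V (λ u → ∑V (h u)) ≡ orderedEdges H
  ∑∑-edge-split h split = ∑∑-symmetrize (vertices n) h (λ u w → 𝟙 (adj H u w)) split

  orderedEdges≡2*upEdges : orderedEdges H ≡ 2 * upEdges
  orderedEdges≡2*upEdges = begin
    orderedEdges H                            ≡⟨ ∑∑-edge-split up2 up2-split ⟨
    ∑V (λ u → ∑V (up2 u))                     ≡⟨ ∑-cong (vertices n) (λ u → ∑-*ˡ (vertices n) 2 (up u)) ⟩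
    ∑V (λ u → 2 * ∑V (up u))                  ≡⟨ ∑-*ˡ (vertices n) 2 (λ u → ∑V (up u)) ⟩
    2 * upEdges                               ∎
    where
    open ≡-Reasoning
    up up2 : Vtx n → Vtx n → ℕ
    up u w = 𝟙 (adj H u w ∧ ⌊ part u <F? part w ⌋)
    up2 u w = 2 * up u w
    up2-split : ∀ u w → up2 u w + up2 w u ≡ 2 * 𝟙 (adj H u w)
    up2-split u w with adj H u w | adj H w u | SubK3.sym H u w | inK H u w
    ... | false | false | _ | _ = refl
    ... | true  | true  | _ | different =
      trans (sym (*-distribˡ-+ 2 (𝟙 ⌊ part u <F? part w ⌋) _)) (cong (2 *_) (𝟙<-split (different refl)))

  edges≡upEdges : edges H ≡ upEdges
  edges≡upEdges = trans (cong ⌊_/2⌋ orderedEdges≡2*upEdges)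
                        (trans (cong (λ k → ⌊ upEdges + k /2⌋) (+-identityʳ upEdges)) (sym (n≡⌊n+n/2⌋ upEdges)))

  ∑∑-edge-split≡2*edges : (h : Vtx n → Vtx n → ℕ) → (∀ u w → h u w + h w u ≡ 2 * 𝟙 (adj H u w)) →
                          ∑V (λ u → ∑V (h u)) ≡ 2 * edges H
  ∑∑-edge-split≡2*edges h split =
    trans (∑∑-edge-split h split) (trans orderedEdges≡2*upEdges (cong (2 *_) (sym edges≡upEdges)))

  ¬~⇒false : ∀ {u w} → ¬ (u ~ w) → adj H u w ≡ false
  ¬~⇒false {u} {w} u≁w with adj H u w
  ... | false = refl
  ... | true  = ⊥-elim (u≁w refl)

  Path3 : Vtx n → Vtx n → Set
  Path3 u v = ∃[ b ] ∃[ c ] u ~ b × b ~ c × c ~ v × u ≢ c × b ≢ v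

  module _ {u v : Vtx n} where

    _~⁺_ : Vtx n → Vtx n → Set
    x ~⁺ y = addEdge (adj H) u v x y ≡ true

    ~⁺-cases : ∀ {x y} → x ~⁺ y → x ~ y ⊎ (x ≡ u × y ≡ v) ⊎ (x ≡ v × y ≡ u)
    ~⁺-cases {x} {y} x~⁺y with adj H x y | x ≟V u | y ≟V v | x ≟V v | y ≟V u
    ... | true  | _      | _      | _      | _      = inj₁ refl
    ... | false | yes x≡u | yes y≡v | _    | _      = inj₂ (inj₁ (x≡u , y≡v))
    ... | false | yes _  | no _   | yes x≡v | yes y≡u = inj₂ (inj₂ (x≡v , y≡u))
    ... | false | no _   | _      | yes x≡v | yes y≡u = inj₂ (inj₂ (x≡v , y≡u))
    ~⁺-cases () | false | yes _ | no _ | yes _ | no _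
    ~⁺-cases () | false | yes _ | no _ | no _  | _
    ~⁺-cases () | false | no _  | _    | yes _ | no _
    ~⁺-cases () | false | no _  | _    | no _  | _

    ~⇒~⁺ : ∀ {x y} → x ~ y → x ~⁺ y
    ~⇒~⁺ x~y rewrite x~y = refl

    uv-~⁺ : u ~⁺ v
    uv-~⁺ with adj H u v | u ≟V u | v ≟V v
    ... | true  | _       | _       = refl
    ... | false | yes _   | yes _   = refl
    ... | false | no u≢u  | _       = ⊥-elim (u≢u refl)
    ... | false | yes _   | no v≢v  = ⊥-elim (v≢v refl)

    vu-~⁺ : v ~⁺ u
    vu-~⁺ with adj H v u | v ≟V v | u ≟V u
    ... | true  | _       | _       = refl
    ... | false | yes _   | yes _   = ∨-zeroʳ _
    ... | false | no v≢v  | _       = ⊥-elim (v≢v refl)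
    ... | false | yes _   | no u≢u  = ⊥-elim (u≢u refl)

    ~⁺-sym : ∀ {x y} → x ~⁺ y → y ~⁺ x
    ~⁺-sym x~⁺y with ~⁺-cases x~⁺y
    ... | inj₁ x~y                 = ~⇒~⁺ (~-sym x~y)
    ... | inj₂ (inj₁ (refl , refl)) = vu-~⁺
    ... | inj₂ (inj₂ (refl , refl)) = uv-~⁺

    ~⁺-old : ∀ {x y} → x ~⁺ y → x ≢ u → x ≢ v → x ~ y
    ~⁺-old x~⁺y x≢u x≢v with ~⁺-cases x~⁺y
    ... | inj₁ x~y              = x~y
    ... | inj₂ (inj₁ (x≡u , _)) = ⊥-elim (x≢u x≡u)
    ... | inj₂ (inj₂ (x≡v , _)) = ⊥-elim (x≢v x≡v)

    -- A 4-cycle p q r s of H + uv whose new edge is pq = uv leaves the path u s r v in H.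
    cycle⇒Path3 : ∀ {p q r s} → p ≡ u → q ≡ v → p ≢ q → p ≢ r → p ≢ s → q ≢ r → q ≢ s →
                  q ~⁺ r → r ~⁺ s → s ~⁺ p → Path3 u v
    cycle⇒Path3 refl refl p≢q p≢r p≢s q≢r q≢s q~⁺r r~⁺s s~⁺p =
      _ , _ , ~-sym (~⁺-old s~⁺p (≢-sym p≢s) (≢-sym q≢s)) , ~-sym (~⁺-old r~⁺s (≢-sym p≢r) (≢-sym q≢r)) ,
      ~⁺-old (~⁺-sym q~⁺r) (≢-sym p≢r) (≢-sym q≢r) , p≢r , ≢-sym q≢s

    C4⁺⇒Path3 : ¬ HasC4 (adj H) → HasC4 (addEdge (adj H) u v) → Path3 u v
    C4⁺⇒Path3 C4-free (p , q , r , s , p≢q , p≢r , p≢s , q≢r , q≢s , r≢s , pq , qr , rs , sp)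
      with ~⁺-cases pq | ~⁺-cases qr | ~⁺-cases rs | ~⁺-cases sp
    ... | inj₂ (inj₁ (p≡u , q≡v)) | _ | _ | _ =
      cycle⇒Path3 p≡u q≡v p≢q p≢r p≢s q≢r q≢s qr rs sp
    ... | inj₂ (inj₂ (p≡v , q≡u)) | _ | _ | _ =
      cycle⇒Path3 q≡u p≡v (≢-sym p≢q) q≢s q≢r p≢s p≢r (~⁺-sym sp) (~⁺-sym rs) (~⁺-sym qr)
    ... | _ | inj₂ (inj₁ (q≡u , r≡v)) | _ | _ =
      cycle⇒Path3 q≡u r≡v q≢r q≢s (≢-sym p≢q) r≢s (≢-sym p≢r) rs sp pq
    ... | _ | inj₂ (inj₂ (q≡v , r≡u)) | _ | _ =
      cycle⇒Path3 r≡u q≡v (≢-sym q≢r) (≢-sym p≢r) r≢s (≢-sym p≢q) q≢s (~⁺-sym pq) (~⁺-sym sp) (~⁺-sym rs)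
    ... | _ | _ | inj₂ (inj₁ (r≡u , s≡v)) | _ =
      cycle⇒Path3 r≡u s≡v r≢s (≢-sym p≢r) (≢-sym q≢r) (≢-sym p≢s) (≢-sym q≢s) sp pq qr
    ... | _ | _ | inj₂ (inj₂ (r≡v , s≡u)) | _ =
      cycle⇒Path3 s≡u r≡v (≢-sym r≢s) (≢-sym q≢s) (≢-sym p≢s) (≢-sym q≢r) (≢-sym p≢r) (~⁺-sym qr) (~⁺-sym pq) (~⁺-sym sp)
    ... | _ | _ | _ | inj₂ (inj₁ (s≡u , p≡v)) =
      cycle⇒Path3 s≡u p≡v (≢-sym p≢s) (≢-sym q≢s) (≢-sym r≢s) p≢q p≢r pq qr rs
    ... | _ | _ | _ | inj₂ (inj₂ (s≡v , p≡u)) =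
      cycle⇒Path3 p≡u s≡v p≢s p≢r p≢q (≢-sym r≢s) (≢-sym q≢s) (~⁺-sym rs) (~⁺-sym qr) (~⁺-sym pq)
    ... | inj₁ pq′ | inj₁ qr′ | inj₁ rs′ | inj₁ sp′ =
      ⊥-elim (C4-free (p , q , r , s , p≢q , p≢r , p≢s , q≢r , q≢s , r≢s , pq′ , qr′ , rs′ , sp′))

  ∑V-supported₁ : ∀ f a → (∀ w → w ≢ a → f w ≡ 0) → ∑V f ≡ f a
  ∑V-supported₁ f a off-a = trans (∑-cong (vertices n) f≡at) (∑V-at a f)
    where
    open PointMass _≟V_
    f≡at : ∀ w → f w ≡ at a f w
    f≡at w with w ≟V a
    ... | yes _   = refl
    ... | no w≢a  = off-a w w≢a

  ∑V-supported₂ : ∀ f {a b} → a ≢ b → (∀ w → w ≢ a → w ≢ b → f w ≡ 0) → ∑V f ≡ f a + f b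
  ∑V-supported₂ f {a} {b} a≢b off-ab =
    trans (∑-cong (vertices n) f≡at+at) (trans (∑-+ (vertices n) (at a f) (at b f)) (cong₂ _+_ (∑V-at a f) (∑V-at b f)))
    where
    open PointMass _≟V_
    f≡at+at : ∀ w → f w ≡ at a f w + at b f w
    f≡at+at w with w ≟V a | w ≟V b
    ... | yes refl | yes refl = ⊥-elim (a≢b refl)
    ... | yes _    | no _     = sym (+-identityʳ (f w))
    ... | no _     | yes _    = refl
    ... | no w≢a   | no w≢b   = off-ab w w≢a w≢b

  ∑V-≥₁ : ∀ f a → f a ≤ ∑V f
  ∑V-≥₁ f a = subst (_≤ ∑V f) (+-identityʳ (f a)) (∑V-sub-≤ f (a ∷ []) ([] ∷ []))

  ∑V-≥₂ : ∀ f {a b} → a ≢ b → f a + f b ≤ ∑V f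
  ∑V-≥₂ f {a} {b} a≢b =
    subst (_≤ ∑V f) (cong (f a +_) (+-identityʳ (f b))) (∑V-sub-≤ f (a ∷ b ∷ []) ((a≢b ∷ []) ∷ [] ∷ []))

  ∑V-≥₃ : ∀ f {a b c} → a ≢ b → a ≢ c → b ≢ c → f a + f b + f c ≤ ∑V f
  ∑V-≥₃ f {a} {b} {c} a≢b a≢c b≢c =
    subst (_≤ ∑V f) (trans (cong (λ k → f a + (f b + k)) (+-identityʳ (f c))) (sym (+-assoc (f a) (f b) (f c))))
          (∑V-sub-≤ f (a ∷ b ∷ c ∷ []) ((a≢b ∷ a≢c ∷ []) ∷ (b≢c ∷ []) ∷ [] ∷ []))

  opaque
    deg : Vtx n → ℕ
    deg u = ∑V (λ w → 𝟙 (adj H u w))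

    deg-≥1 : ∀ {u a} → u ~ a → 1 ≤ deg u
    deg-≥1 {u} {a} u~a = subst (λ k → 𝟙 k ≤ deg u) u~a (∑V-≥₁ (λ w → 𝟙 (adj H u w)) a)

    deg-≥2 : ∀ {u a b} → a ≢ b → u ~ a → u ~ b → 2 ≤ deg u
    deg-≥2 {u} {a} {b} a≢b u~a u~b =
      subst₂ (λ k l → 𝟙 k + 𝟙 l ≤ deg u) u~a u~b (∑V-≥₂ (λ w → 𝟙 (adj H u w)) a≢b)

    deg-≤1 : ∀ {u} a → (∀ {w} → u ~ w → w ≡ a) → deg u ≤ 1
    deg-≤1 {u} a only-a = subst (_≤ 1) (sym (∑V-supported₁ (λ w → 𝟙 (adj H u w)) a off-a)) (𝟙≤1 (adj H u a))
      where
      𝟙≤1 : ∀ b → 𝟙 b ≤ 1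
      𝟙≤1 false = z≤n
      𝟙≤1 true  = s≤s z≤n
      off-a : ∀ w → w ≢ a → 𝟙 (adj H u w) ≡ 0
      off-a w w≢a with adj H u w in u~w
      ... | false = refl
      ... | true  = ⊥-elim (w≢a (only-a u~w))

module Discharging {n : ℕ} (H : SubK3 n) {L : Vtx n → Set} (L? : Decidable L)
                   (no-L-edge : ∀ {u w} → Graph._~_ H u w → L u → L w → ⊥) where
  open Graph H

  charge : Vtx n → Vtx n → ℕ
  charge u w = if adj H u w then (if ⌊ L? u ⌋ then 2 else if ⌊ L? w ⌋ then 0 else 1) else 0

  received : Vtx n → ℕ
  received u = ∑V (charge u)

  charge-split : ∀ u w → charge u w + charge w u ≡ 2 * 𝟙 (adj H u w)
  charge-split u w with adj H u w | adj H w u | SubK3.sym H u w | no-L-edge {u} {w}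
  ... | false | false | _ | _ = refl
  ... | true  | true  | _ | no-LL with L? u | L? w
  ...   | yes Lu | yes Lw = ⊥-elim (no-LL refl Lu Lw)
  ...   | yes _  | no _   = refl
  ...   | no _   | yes _  = refl
  ...   | no _   | no _   = refl

  ∑received≡2*edges : ∑V received ≡ 2 * edges H
  ∑received≡2*edges = ∑∑-edge-split≡2*edges charge charge-split

  received≥2⇒3n≤edges : (∀ u → 2 ≤ received u) → 3 * n ≤ edges H
  received≥2⇒3n≤edges 2≤received = *-cancelˡ-≤ 2 (begin
    2 * (3 * n)                   ≡⟨ cong (2 *_) (length-vertices n) ⟨
    2 * length (vertices n)       ≤⟨ ∑-≥ (vertices n) 2 received 2≤received ⟩
    ∑V received                   ≡⟨ ∑received≡2*edges ⟩
    2 * edges H                   ∎)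
    where open ≤-Reasoning

  edges≡3n⇒received≡2 : (∀ u → 2 ≤ received u) → edges H ≡ 3 * n → ∀ u → received u ≡ 2
  edges≡3n⇒received≡2 2≤received edges≡3n u =
    ∑-tight (vertices n) 2 received 2≤received (≤-reflexive ∑≡) (∈-vertices u)
    where
    ∑≡ : ∑V received ≡ 2 * length (vertices n)
    ∑≡ = trans ∑received≡2*edges (cong (2 *_) (trans edges≡3n (sym (length-vertices n))))

  received≡2⇒edges≡3n : (∀ u → received u ≡ 2) → edges H ≡ 3 * n
  received≡2⇒edges≡3n received≡2 = *-cancelˡ-≡ (edges H) (3 * n) 2 (begin
    2 * edges H                   ≡⟨ ∑received≡2*edges ⟨
    ∑V received                   ≡⟨ ∑-cong (vertices n) received≡2 ⟩
    ∑V (λ _ → 2)                  ≡⟨ ∑-const (vertices n) 2 ⟩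
    2 * length (vertices n)       ≡⟨ cong (2 *_) (length-vertices n) ⟩
    2 * (3 * n)                   ∎)
    where open ≡-Reasoning

  charge-from-L : ∀ {u w} → L u → u ~ w → charge u w ≡ 2
  charge-from-L {u} Lu u~w rewrite u~w with L? u
  ... | yes _  = refl
  ... | no ¬Lu = contradiction Lu ¬Lu

  charge-inner : ∀ {u w} → ¬ L u → u ~ w → ¬ L w → charge u w ≡ 1
  charge-inner {u} {w} ¬Lu u~w ¬Lw rewrite u~w with L? u | L? w
  ... | yes Lu | _      = contradiction Lu ¬Lu
  ... | no _   | yes Lw = contradiction Lw ¬Lw
  ... | no _   | no _   = refl

  charge-non-adj : ∀ {u w} → adj H u w ≡ false → charge u w ≡ 0
  charge-non-adj u≁w rewrite u≁w = refl

  charge-to-L : ∀ {u w} → ¬ L u → L w → charge u w ≡ 0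
  charge-to-L {u} {w} ¬Lu Lw with adj H u w | L? u | L? w
  ... | false | _      | _      = refl
  ... | true  | yes Lu | _      = contradiction Lu ¬Lu
  ... | true  | no _   | yes _  = refl
  ... | true  | no _   | no ¬Lw = contradiction Lw ¬Lw

cover-outside-part₀ : ∀ {n} (zs : List (Vtx n)) → (∀ {u} → part u ≢ zero → u ∈ zs) → n + n ≤ length zs
cover-outside-part₀ {n} zs cover = injective⇒≤ {f = λ t → index (cover (e-off t))} index-injective
  where
  embed : Fin n ⊎ Fin n → Vtx n
  embed (inj₁ t) = (suc zero , t)
  embed (inj₂ t) = (suc (suc zero) , t)
  embed-off : ∀ p → part (embed p) ≢ zero
  embed-off (inj₁ _) ()
  embed-off (inj₂ _) ()
  embed-injective : ∀ {p q} → embed p ≡ embed q → p ≡ q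
  embed-injective {inj₁ _} {inj₁ _} refl = refl
  embed-injective {inj₂ _} {inj₂ _} refl = refl
  embed-injective {inj₁ _} {inj₂ _} ()
  embed-injective {inj₂ _} {inj₁ _} ()
  e : Fin (n + n) → Vtx n
  e t = embed (splitAt n t)
  e-off : ∀ t → part (e t) ≢ zero
  e-off t = embed-off (splitAt n t)
  e-injective : ∀ {s t} → e s ≡ e t → s ≡ t
  e-injective {s} {t} es≡et =
    trans (sym (join-splitAt n n s)) (trans (cong (join n n) (embed-injective es≡et)) (join-splitAt n n t))
  index-injective : ∀ {s t} → index (cover (e-off s)) ≡ index (cover (e-off t)) → s ≡ t
  index-injective {s} {t} i≡ = e-injective (trans (lookup-index (cover (e-off s)))
                                           (trans (cong (lookup zs) i≡) (sym (lookup-index (cover (e-off t))))))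

three-in-part⇒3≤n : ∀ {n} {p q r : Vtx n} → part p ≡ part q → part p ≡ part r →
                    p ≢ q → p ≢ r → q ≢ r → 3 ≤ n
three-in-part⇒3≤n {n} {p} {q} {r} p≡q p≡r p≢q p≢r q≢r = injective⇒≤ {f = index-of} index-injective
  where
  index-of : Fin 3 → Fin n
  index-of zero             = proj₂ p
  index-of (suc zero)       = proj₂ q
  index-of (suc (suc zero)) = proj₂ r
  same : ∀ {u w : Vtx n} → part u ≡ part w → proj₂ u ≡ proj₂ w → u ≡ w
  same refl refl = refl
  index-injective : ∀ {s t} → index-of s ≡ index-of t → s ≡ t
  index-injective {zero}             {zero}             _ = refl
  index-injective {suc zero}         {suc zero}         _ = refl
  index-injective {suc (suc zero)}   {suc (suc zero)}   _ = refl
  index-injective {zero}             {suc zero}         e = ⊥-elim (p≢q (same p≡q e))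
  index-injective {zero}             {suc (suc zero)}   e = ⊥-elim (p≢r (same p≡r e))
  index-injective {suc zero}         {zero}             e = ⊥-elim (p≢q (same p≡q (sym e)))
  index-injective {suc zero}         {suc (suc zero)}   e = ⊥-elim (q≢r (same (trans (sym p≡q) p≡r) e))
  index-injective {suc (suc zero)}   {zero}             e = ⊥-elim (p≢r (same p≡r (sym e)))
  index-injective {suc (suc zero)}   {suc zero}         e = ⊥-elim (q≢r (same (trans (sym p≡q) p≡r) (sym e)))

three-cover-impossible : ∀ {m} {z₁ z₂ z₃ : Vtx (suc (suc m))} →
                         ¬ (∀ {u} → part u ≢ zero → u ∈ z₁ ∷ z₂ ∷ z₃ ∷ [])
three-cover-impossible cover = n≮n 3 (≤-trans (+-mono-≤ 2≤n 2≤n) (cover-outside-part₀ _ cover))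
  where
  2≤n : 2 ≤ suc (suc _)
  2≤n = s≤s (s≤s z≤n)

module Saturated {m : ℕ} (H : SubK3 (suc (suc m))) (saturated : C4Saturated H) where
  open Graph H

  V : Set
  V = Vtx (suc (suc m))

  C4-free : ¬ HasC4 (adj H)
  C4-free = proj₁ saturated

  -- The existence lemmas of this development are opaque: `with` on a transparent one
  -- normalises the whole search behind it.
  opaque
    path : ∀ {u v} → part u ≢ part v → adj H u v ≡ false → Path3 u v
    path {u} {v} u≢v u≁v = C4⁺⇒Path3 C4-free (proj₂ saturated u v u≢v u≁v)

  another-vertex : ∀ k (w : V) → ∃[ u ] part u ≡ k × u ≢ w
  another-vertex k w with (k , zero) ≟V w
  ... | yes refl = (k , suc zero) , refl , λ ()
  ... | no k0≢w  = (k , zero) , refl , k0≢w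

  opaque
    has-nbr : ∀ u → ∃ (u ~_)
    has-nbr u with Fin3-avoid₂ (part u) (part u)
    ... | k , u≢k , _ with adj H u (k , zero) in u~w
    ...   | true  = _ , u~w
    ...   | false with path u≢k u~w
    ...     | b , _ , u~b , _ = b , u~b

  Leaf : V → Set
  Leaf u = deg u ≡ 1

  leaf? : ∀ u → Dec (Leaf u)
  leaf? u = deg u ≟ 1

  two-nbrs⇒¬leaf : ∀ {u a b} → a ≢ b → u ~ a → u ~ b → ¬ Leaf u
  two-nbrs⇒¬leaf a≢b u~a u~b leaf = n≮n 1 (subst (2 ≤_) leaf (deg-≥2 a≢b u~a u~b))

  leaf-nbr-unique : ∀ {u a b} → Leaf u → u ~ a → u ~ b → a ≡ b
  leaf-nbr-unique {a = a} {b} leaf u~a u~b with a ≟V b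
  ... | yes a≡b = a≡b
  ... | no a≢b  = contradiction leaf (two-nbrs⇒¬leaf a≢b u~a u~b)

  opaque
    ¬leaf⇒two-nbrs : ∀ {u} → ¬ Leaf u → ∃₂ λ a b → a ≢ b × u ~ a × u ~ b
    ¬leaf⇒two-nbrs {u} ¬leaf with has-nbr u
    ... | a , u~a with any-vertex? (λ b → ¬? (a ≟V b) ×-dec (adj H u b ≟B true))
    ...   | yes (b , a≢b , u~b) = a , b , a≢b , u~a , u~b
    ...   | no ∄b = ⊥-elim (¬leaf (≤-antisym (deg-≤1 a only-a) (deg-≥1 u~a)))
      where
      only-a : ∀ {w} → u ~ w → w ≡ a
      only-a {w} u~w with a ≟V w
      ... | yes a≡w = sym a≡w
      ... | no a≢w  = ⊥-elim (∄b (w , a≢w , u~w))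

  infix 4 _~ᴵ_
  _~ᴵ_ : V → V → Set
  w ~ᴵ b = w ~ b × ¬ Leaf b

  -- Saturating the non-edge vu forces a path v w c u, and c has the two neighbours w and u.
  opaque
    leaf-reach : ∀ {v w u} → Leaf v → v ~ w → part u ≢ part v → u ≢ w →
                 ∃[ c ] w ~ᴵ c × c ~ u × c ≢ v
    leaf-reach {v} {w} {u} leaf v~w u≢v u≢w with adj H v u in v~u
    ... | true = contradiction (leaf-nbr-unique leaf v~u v~w) u≢w
    ... | false with path (≢-sym u≢v) v~u
    ...   | b , c , v~b , b~c , c~u , v≢c , _ with leaf-nbr-unique leaf v~b v~w
    ...     | refl = c , (b~c , two-nbrs⇒¬leaf (≢-sym u≢w) (~-sym b~c) c~u) , c~u , ≢-sym v≢c

  opaque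
    leaf-nbr-inner-nbr : ∀ {v w} → Leaf v → v ~ w → ∃[ c ] w ~ᴵ c × c ≢ v
    leaf-nbr-inner-nbr {v} {w} leaf v~w with another-vertex (part w) w
    ... | u , refl , u≢w with leaf-reach leaf v~w (≢-sym (~-part v~w)) u≢w
    ...   | c , w~ᴵc , _ , c≢v = c , w~ᴵc , c≢v

  leaf-nbr-¬leaf : ∀ {v w} → Leaf v → v ~ w → ¬ Leaf w
  leaf-nbr-¬leaf leaf v~w with leaf-nbr-inner-nbr leaf v~w
  ... | c , (w~c , _) , c≢v = two-nbrs⇒¬leaf (≢-sym c≢v) (~-sym v~w) w~c

  module OnlyInnerNbr {v w b} (leaf : Leaf v) (v~w : v ~ w) (w~ᴵb : w ~ᴵ b)
                      (only-b : ∀ {c} → w ~ᴵ c → c ≡ b) {k} (v≢k : part v ≢ k) (w≢k : part w ≢ k) where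

    reaches-via-b : ∀ {u} → part u ≢ part v → u ≢ w → b ~ u
    reaches-via-b u≢v u≢w with leaf-reach leaf v~w u≢v u≢w
    ... | c , w~ᴵc , c~u , _ with only-b w~ᴵc
    ...   | refl = c~u

    part-b≡v : part b ≡ part v
    part-b≡v = Fin3-third-unique w≢k (≢-sym (~-part v~w)) (≢-sym v≢k) (λ b≡w → ~-part (proj₁ w~ᴵb) (sym b≡w)) b≢k
      where
      b≢k : part b ≢ k
      b≢k b≡k with another-vertex k b
      ... | u , u∈k , u≢b =
        ~-part (reaches-via-b {u} (λ u≡v → v≢k (trans (sym u≡v) u∈k)) (λ { refl → w≢k u∈k })) (trans b≡k (sym u∈k))

    y : Fin (suc (suc m)) → V
    y t = (k , t)

    b~y : ∀ t → b ~ y t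
    b~y t = reaches-via-b {y t} (λ k≡v → v≢k (sym k≡v)) (λ y≡w → w≢k (cong part (sym y≡w)))

    w≁y : ∀ t → adj H w (y t) ≡ false
    w≁y t with adj H w (y t) in w~y
    ... | false = refl
    ... | true with only-b (w~y , two-nbrs⇒¬leaf (~-irrefl (proj₁ w~ᴵb)) (~-sym w~y) (~-sym (b~y t)))
    ...   | y≡b = ⊥-elim (v≢k (trans (sym part-b≡v) (cong part (sym y≡b))))

    via-b : ∀ t → ∃[ c ] b ~ c × c ~ y t × c ≢ w × part c ≡ part w
    via-b t with path w≢k (w≁y t)
    ... | a , c , w~a , a~c , c~y , w≢c , _ with only-b (w~a , two-nbrs⇒¬leaf w≢c (~-sym w~a) a~c)
    ...   | refl = c , a~c , c~y , ≢-sym w≢c ,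
                   Fin3-third-unique v≢k (~-part v~w) (≢-sym w≢k)
                     (λ c≡v → ~-part a~c (trans part-b≡v (sym c≡v))) (~-part c~y)

    g : Fin (suc (suc m)) → Fin (suc (suc m))
    g t = proj₂ (proj₁ (via-b t))

    via-b≡ : ∀ t → proj₁ (via-b t) ≡ (part w , g t)
    via-b≡ t = cong (_, g t) (proj₂ (proj₂ (proj₂ (proj₂ (via-b t)))))

    g≢w : ∀ t → proj₂ w ≢ g t
    g≢w t w≡g = proj₁ (proj₂ (proj₂ (proj₂ (via-b t)))) (trans (via-b≡ t) (cong (part w ,_) (sym w≡g)))

    -- Two vertices y t₁, y t₂ with the same c would close the 4-cycle y t₁ c y t₂ b.
    g-injective : ∀ {t₁ t₂} → g t₁ ≡ g t₂ → t₁ ≡ t₂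
    g-injective {t₁} {t₂} g≡ = decidable-stable (t₁ ≟F t₂) λ t₁≢t₂ → C4-free (y t₁ , c , y t₂ , b ,
      ~-irrefl (~-sym c~y₁) , (λ y≡ → t₁≢t₂ (cong proj₂ y≡)) , ~-irrefl (~-sym (b~y t₁)) ,
      ~-irrefl c~y₂ , ~-irrefl (~-sym b~c) , ~-irrefl (~-sym (b~y t₂)) ,
      ~-sym c~y₁ , c~y₂ , ~-sym (b~y t₂) , b~y t₁)
      where
      c : V
      c = proj₁ (via-b t₁)
      b~c : b ~ c
      b~c = proj₁ (proj₂ (via-b t₁))
      c~y₁ : c ~ y t₁
      c~y₁ = proj₁ (proj₂ (proj₂ (via-b t₁)))
      c~y₂ : c ~ y t₂
      c~y₂ = subst (_~ y t₂) (trans (via-b≡ t₂) (trans (cong (part w ,_) (sym g≡)) (sym (via-b≡ t₁))))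
                   (proj₁ (proj₂ (proj₂ (via-b t₂))))

    impossible : ⊥
    impossible = n≮n (suc m) (injective⇒≤ {f = λ t → punchOut (g≢w t)}
                                (λ p≡ → g-injective (punchOut-injective (g≢w _) (g≢w _) p≡)))

  opaque
    leaf-nbr-two-inner-nbrs : ∀ {v w} → Leaf v → v ~ w → ∃₂ λ b₁ b₂ → b₁ ≢ b₂ × w ~ᴵ b₁ × w ~ᴵ b₂
    leaf-nbr-two-inner-nbrs {v} {w} leaf v~w with leaf-nbr-inner-nbr leaf v~w
    ... | b , w~ᴵb , _ with any-vertex? (λ c → (¬? (b ≟V c) ×-dec (adj H w c ≟B true)) ×-dec ¬? (leaf? c))
    ...   | yes (c , (b≢c , w~c) , ¬leaf-c) = b , c , b≢c , w~ᴵb , (w~c , ¬leaf-c)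
    ...   | no ∄c with Fin3-avoid₂ (part v) (part w)
    ...     | k , v≢k , w≢k = ⊥-elim (OnlyInnerNbr.impossible leaf v~w w~ᴵb only-b v≢k w≢k)
      where
      only-b : ∀ {c} → w ~ᴵ c → c ≡ b
      only-b {c} (w~c , ¬leaf-c) with b ≟V c
      ... | yes b≡c = sym b≡c
      ... | no b≢c  = ⊥-elim (∄c (c , (b≢c , w~c) , ¬leaf-c))

  opaque
    inner-two-inner-nbrs : ∀ {w} → ¬ Leaf w → ∃₂ λ b₁ b₂ → b₁ ≢ b₂ × w ~ᴵ b₁ × w ~ᴵ b₂
    inner-two-inner-nbrs ¬leaf with ¬leaf⇒two-nbrs ¬leaf
    ... | a₁ , a₂ , a₁≢a₂ , w~a₁ , w~a₂ with leaf? a₁ | leaf? a₂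
    ...   | yes leaf₁ | _         = leaf-nbr-two-inner-nbrs leaf₁ (~-sym w~a₁)
    ...   | no _      | yes leaf₂ = leaf-nbr-two-inner-nbrs leaf₂ (~-sym w~a₂)
    ...   | no ¬leaf₁ | no ¬leaf₂ = a₁ , a₂ , a₁≢a₂ , (w~a₁ , ¬leaf₁) , (w~a₂ , ¬leaf₂)

  open Discharging H leaf? (λ u~w leaf-u → leaf-nbr-¬leaf leaf-u u~w) public

  received-≥2 : ∀ u → 2 ≤ received u
  received-≥2 u = by-leafness (leaf? u)
    where
    by-leafness : Dec (Leaf u) → 2 ≤ received u
    by-leafness (yes leaf) with has-nbr u
    ... | a , u~a = subst (_≤ received u) (charge-from-L leaf u~a) (∑V-≥₁ (charge u) a)
    by-leafness (no ¬leaf) with inner-two-inner-nbrs ¬leaf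
    ... | b₁ , b₂ , b₁≢b₂ , (u~b₁ , ¬leaf₁) , (u~b₂ , ¬leaf₂) =
      subst (_≤ received u) (cong₂ _+_ (charge-inner ¬leaf u~b₁ ¬leaf₁) (charge-inner ¬leaf u~b₂ ¬leaf₂))
            (∑V-≥₂ (charge u) b₁≢b₂)

  3n≤edges-saturated : 3 * suc (suc m) ≤ edges H
  3n≤edges-saturated = received≥2⇒3n≤edges received-≥2

  opaque
    leaf-nbrs-distinct : ∀ {p p′ t} → Leaf p → Leaf p′ → part p ≢ part p′ → p ~ t → p′ ~ t → ⊥
    leaf-nbrs-distinct {p} {p′} leaf leaf′ p≢p′ p~t p′~t with adj H p p′ in p~p′
    ... | true with leaf-nbr-unique leaf p~p′ p~t
    ...   | refl = ~-irrefl p′~t refl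
    leaf-nbrs-distinct {p} {p′} leaf leaf′ p≢p′ p~t p′~t | false with path p≢p′ p~p′
    ... | a , c , p~a , a~c , c~p′ , _ with leaf-nbr-unique leaf p~a p~t | leaf-nbr-unique leaf′ (~-sym c~p′) p′~t
    ...   | refl | refl = ~-irrefl a~c refl

module Extremal {m : ℕ} (H : SubK3 (suc (suc m))) (saturated : C4Saturated H)
                (extremal : edges H ≡ 3 * suc (suc m)) where
  open Graph H
  open Saturated H saturated

  received≡2-extremal : ∀ u → received u ≡ 2
  received≡2-extremal = edges≡3n⇒received≡2 received-≥2 extremal

  opaque
    at-most-two-inner-nbrs : ∀ {t y₁ y₂ c} → ¬ Leaf t → y₁ ≢ y₂ → t ~ᴵ y₁ → t ~ᴵ y₂ → t ~ᴵ c →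
                             c ≡ y₁ ⊎ c ≡ y₂
    at-most-two-inner-nbrs {t} {y₁} {y₂} {c} ¬leaf y₁≢y₂ (t~y₁ , ¬leaf₁) (t~y₂ , ¬leaf₂) (t~c , ¬leaf-c)
      with c ≟V y₁ | c ≟V y₂
    ... | yes c≡y₁ | _        = inj₁ c≡y₁
    ... | no _     | yes c≡y₂ = inj₂ c≡y₂
    ... | no c≢y₁  | no c≢y₂  = ⊥-elim (n≮n 2 (subst (3 ≤_) (received≡2-extremal t) (subst (_≤ received t)
            (cong₂ _+_ (cong₂ _+_ (charge-inner ¬leaf t~y₁ ¬leaf₁) (charge-inner ¬leaf t~y₂ ¬leaf₂))
                       (charge-inner ¬leaf t~c ¬leaf-c))
            (∑V-≥₃ (charge t) y₁≢y₂ (≢-sym c≢y₁) (≢-sym c≢y₂)))))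

  opaque
    other-inner-nbr : ∀ {t z} → ¬ Leaf t → t ~ᴵ z →
                      ∃[ z′ ] z′ ≢ z × t ~ᴵ z′ × (∀ {c} → t ~ᴵ c → c ≡ z ⊎ c ≡ z′)
    other-inner-nbr ¬leaf t~ᴵz with inner-two-inner-nbrs ¬leaf
    ... | b₁ , b₂ , b₁≢b₂ , t~ᴵb₁ , t~ᴵb₂ with at-most-two-inner-nbrs ¬leaf b₁≢b₂ t~ᴵb₁ t~ᴵb₂ t~ᴵz
    ...   | inj₁ refl = b₂ , ≢-sym b₁≢b₂ , t~ᴵb₂ , at-most-two-inner-nbrs ¬leaf b₁≢b₂ t~ᴵb₁ t~ᴵb₂
    ...   | inj₂ refl = b₁ , b₁≢b₂ , t~ᴵb₁ , λ t~ᴵc → swap (at-most-two-inner-nbrs ¬leaf b₁≢b₂ t~ᴵb₁ t~ᴵb₂ t~ᴵc)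

  leaf-in-part-of-nonadjacent : ∀ {p t z₁ z₂} → Leaf p → p ~ t → t ~ᴵ z₁ → t ~ᴵ z₂ → z₁ ≢ z₂ →
                                adj H z₁ z₂ ≡ false → part z₁ ≡ part p
  leaf-in-part-of-nonadjacent {p} {t} {z₁} leaf p~t t~ᴵz₁ t~ᴵz₂ z₁≢z₂ z₁≁z₂ with part z₁ ≟F part p
  ... | yes z₁≡p = z₁≡p
  ... | no z₁≢p with leaf-reach leaf p~t z₁≢p (≢-sym (~-irrefl (proj₁ t~ᴵz₁)))
  ...   | c , t~ᴵc , c~z₁ , _
          with at-most-two-inner-nbrs (leaf-nbr-¬leaf leaf p~t) z₁≢z₂ t~ᴵz₁ t~ᴵz₂ t~ᴵc
  ...     | inj₁ refl = ⊥-elim (~-irrefl c~z₁ refl)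
  ...     | inj₂ refl = contradiction (trans (sym (~-sym c~z₁)) z₁≁z₂) λ ()

  module AttachedTriangle {v x z₁ z₂} (leaf : Leaf v) (v~x : v ~ x)
                          (x~ᴵz₁ : x ~ᴵ z₁) (x~ᴵz₂ : x ~ᴵ z₂) (z₁≢z₂ : z₁ ≢ z₂) where

    x-inner : ¬ Leaf x
    x-inner = leaf-nbr-¬leaf leaf v~x

    opaque
      x-inner-nbrs : ∀ {c} → x ~ᴵ c → c ≡ z₁ ⊎ c ≡ z₂
      x-inner-nbrs = at-most-two-inner-nbrs x-inner z₁≢z₂ x~ᴵz₁ x~ᴵz₂

    opaque
      covered : ∀ {u} → part u ≢ part v → u ≢ x → z₁ ~ u ⊎ z₂ ~ u
      covered u≢v u≢x with leaf-reach leaf v~x u≢v u≢x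
      ... | c , x~ᴵc , c~u , _ with x-inner-nbrs x~ᴵc
      ...   | inj₁ refl = inj₁ c~u
      ...   | inj₂ refl = inj₂ c~u

    -- Apart from x, a vertex s ∈ {z₁, z₂} sees only its other inner neighbour s′ and
    -- leaves of the part of x; if it sees such a leaf, s′ lies in that part as well.
    Beyond : V → V → Set
    Beyond s s′ = ∀ {u} → s ~ u → u ≢ x → u ≡ s′ ⊎ (part x ≡ part u × part s′ ≡ part u)

    opaque
      beyond : ∀ {s s̄} → x ~ᴵ s → x ~ᴵ s̄ → s ≢ s̄ → adj H s s̄ ≡ false → ∃[ s′ ] Beyond s s′
      beyond {s} {s̄} x~ᴵs x~ᴵs̄ s≢s̄ s≁s̄ with other-inner-nbr (proj₂ x~ᴵs) (~-sym (proj₁ x~ᴵs) , x-inner)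
      ... | s′ , s′≢x , s~ᴵs′ , s-inner-nbrs = s′ , s-beyond
        where
        x≁s′ : adj H x s′ ≡ false
        x≁s′ with adj H x s′ in x~s′
        ... | false = refl
        ... | true with at-most-two-inner-nbrs x-inner s≢s̄ x~ᴵs x~ᴵs̄ (x~s′ , proj₂ s~ᴵs′)
        ...   | inj₁ refl = ⊥-elim (~-irrefl (proj₁ s~ᴵs′) refl)
        ...   | inj₂ refl = contradiction (trans (sym (proj₁ s~ᴵs′)) s≁s̄) λ ()
        s′≁x : adj H s′ x ≡ false
        s′≁x = trans (SubK3.sym H s′ x) x≁s′
        s~ᴵx : s ~ᴵ x
        s~ᴵx = ~-sym (proj₁ x~ᴵs) , x-inner
        s-beyond : Beyond s s′
        s-beyond {u} s~u u≢x with leaf? u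
        ... | no ¬leaf-u with s-inner-nbrs (s~u , ¬leaf-u)
        ...   | inj₁ u≡x  = ⊥-elim (u≢x u≡x)
        ...   | inj₂ u≡s′ = inj₁ u≡s′
        s-beyond {u} s~u u≢x | yes leaf-u =
          inj₂ (leaf-in-part-of-nonadjacent leaf-u (~-sym s~u) s~ᴵx s~ᴵs′ (≢-sym s′≢x) x≁s′ ,
                leaf-in-part-of-nonadjacent leaf-u (~-sym s~u) s~ᴵs′ s~ᴵx s′≢x s′≁x)

    -- The third part k would have to consist of the single vertex t′.
    beyond-contradiction : ∀ {s s̄ s′ t′} → Beyond s s′ → Beyond s̄ t′ →
                           (∀ {u} → part u ≢ part v → u ≢ x → s ~ u ⊎ s̄ ~ u) →
                           ∀ {u₀} → part u₀ ≡ part x → u₀ ≢ x → s ~ u₀ → ⊥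
    beyond-contradiction {s′ = s′} {t′} beyond-s beyond-s̄ cover {u₀} u₀∈x u₀≢x s~u₀
      with Fin3-avoid₂ (part v) (part x)
    ... | k , v≢k , x≢k = 0≢1 (cong proj₂ (trans (is-t′ zero) (sym (is-t′ (suc zero)))))
      where
      0≢1 : zero ≢ suc zero
      0≢1 ()
      s′∈x : part s′ ≡ part x
      s′∈x with beyond-s s~u₀ u₀≢x
      ... | inj₁ u₀≡s′       = trans (cong part (sym u₀≡s′)) u₀∈x
      ... | inj₂ (_ , s′≡u₀) = trans s′≡u₀ u₀∈x
      is-t′ : ∀ t → (k , t) ≡ t′
      is-t′ t with cover {k , t} (≢-sym v≢k) (λ kt≡x → x≢k (cong part (sym kt≡x)))
      ... | inj₁ s~kt with beyond-s s~kt (λ kt≡x → x≢k (cong part (sym kt≡x)))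
      ...   | inj₁ kt≡s′      = ⊥-elim (x≢k (trans (sym s′∈x) (cong part (sym kt≡s′))))
      ...   | inj₂ (x≡k , _)  = ⊥-elim (x≢k x≡k)
      is-t′ t | inj₂ s̄~kt with beyond-s̄ s̄~kt (λ kt≡x → x≢k (cong part (sym kt≡x)))
      ...   | inj₁ kt≡t′      = kt≡t′
      ...   | inj₂ (x≡k , _)  = ⊥-elim (x≢k x≡k)

    module _ (z₁≁z₂ : adj H z₁ z₂ ≡ false) where

      beyond₁ : ∃[ s′ ] Beyond z₁ s′
      beyond₁ = beyond x~ᴵz₁ x~ᴵz₂ z₁≢z₂ z₁≁z₂

      beyond₂ : ∃[ s′ ] Beyond z₂ s′
      beyond₂ = beyond x~ᴵz₂ x~ᴵz₁ (≢-sym z₁≢z₂) (trans (SubK3.sym H z₂ z₁) z₁≁z₂)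

      non-adjacent-impossible : ⊥
      non-adjacent-impossible with another-vertex (part x) x
      ... | u₀ , u₀∈x , u₀≢x with covered (λ u₀≡v → ~-part v~x (trans (sym u₀≡v) u₀∈x)) u₀≢x
      ...   | inj₁ z₁~u₀ = beyond-contradiction (proj₂ beyond₁) (proj₂ beyond₂) covered u₀∈x u₀≢x z₁~u₀
      ...   | inj₂ z₂~u₀ = beyond-contradiction (proj₂ beyond₂) (proj₂ beyond₁)
                             (λ u≢v u≢x → swap (covered u≢v u≢x)) u₀∈x u₀≢x z₂~u₀

    z₁~z₂ : z₁ ~ z₂
    z₁~z₂ = decidable-stable (adj H z₁ z₂ ≟B true) λ z₁≁z₂ → non-adjacent-impossible (¬~⇒false z₁≁z₂)

    InT : V → Set
    InT u = u ≡ x ⊎ u ≡ z₁ ⊎ u ≡ z₂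

    T-adj : ∀ {a b} → InT a → InT b → a ≢ b → a ~ b
    T-adj (inj₁ refl)        (inj₁ refl)        a≢b = ⊥-elim (a≢b refl)
    T-adj (inj₁ refl)        (inj₂ (inj₁ refl)) _   = proj₁ x~ᴵz₁
    T-adj (inj₁ refl)        (inj₂ (inj₂ refl)) _   = proj₁ x~ᴵz₂
    T-adj (inj₂ (inj₁ refl)) (inj₁ refl)        _   = ~-sym (proj₁ x~ᴵz₁)
    T-adj (inj₂ (inj₁ refl)) (inj₂ (inj₁ refl)) a≢b = ⊥-elim (a≢b refl)
    T-adj (inj₂ (inj₁ refl)) (inj₂ (inj₂ refl)) _   = z₁~z₂
    T-adj (inj₂ (inj₂ refl)) (inj₁ refl)        _   = ~-sym (proj₁ x~ᴵz₂)
    T-adj (inj₂ (inj₂ refl)) (inj₂ (inj₁ refl)) _   = ~-sym z₁~z₂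
    T-adj (inj₂ (inj₂ refl)) (inj₂ (inj₂ refl)) a≢b = ⊥-elim (a≢b refl)

    T-part-injective : ∀ {a b} → InT a → InT b → part a ≡ part b → a ≡ b
    T-part-injective {a} {b} a∈T b∈T a≡b = decidable-stable (a ≟V b) λ a≢b → ~-part (T-adj a∈T b∈T a≢b) a≡b

    opaque
      T-inner-nbrs : ∀ {t c} → InT t → t ~ᴵ c → InT c
      T-inner-nbrs (inj₁ refl) x~ᴵc with x-inner-nbrs x~ᴵc
      ... | inj₁ c≡z₁ = inj₂ (inj₁ c≡z₁)
      ... | inj₂ c≡z₂ = inj₂ (inj₂ c≡z₂)
      T-inner-nbrs (inj₂ (inj₁ refl)) z₁~ᴵc
        with at-most-two-inner-nbrs (proj₂ x~ᴵz₁) (~-irrefl (proj₁ x~ᴵz₂))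
               (~-sym (proj₁ x~ᴵz₁) , x-inner) (z₁~z₂ , proj₂ x~ᴵz₂) z₁~ᴵc
      ... | inj₁ c≡x  = inj₁ c≡x
      ... | inj₂ c≡z₂ = inj₂ (inj₂ c≡z₂)
      T-inner-nbrs (inj₂ (inj₂ refl)) z₂~ᴵc
        with at-most-two-inner-nbrs (proj₂ x~ᴵz₂) (~-irrefl (proj₁ x~ᴵz₁))
               (~-sym (proj₁ x~ᴵz₂) , x-inner) (~-sym z₁~z₂ , proj₂ x~ᴵz₁) z₂~ᴵc
      ... | inj₁ c≡x  = inj₁ c≡x
      ... | inj₂ c≡z₁ = inj₂ (inj₁ c≡z₁)

    T-outer-nbr-leaf : ∀ {t u} → InT t → t ~ u → ¬ InT u → Leaf u
    T-outer-nbr-leaf {u = u} t∈T t~u u∉T = decidable-stable (leaf? u) λ ¬leaf → u∉T (T-inner-nbrs t∈T (t~u , ¬leaf))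

    opaque
      attached : ∀ {p t u} → Leaf p → p ~ t → InT t → part u ≢ part p → ¬ InT u →
                 Leaf u × ∃[ t′ ] InT t′ × u ~ t′
      attached leaf p~t t∈T u≢p u∉T with leaf-reach leaf p~t u≢p (λ { refl → u∉T t∈T })
      ... | c , t~ᴵc , c~u , _ = T-outer-nbr-leaf c∈T c~u u∉T , c , c∈T , ~-sym c~u
        where
        c∈T : InT c
        c∈T = T-inner-nbrs t∈T t~ᴵc

    opaque
      T-meets-part : ∀ i → ∃[ t ] part t ≡ i × InT t
      T-meets-part i with part x ≟F i | part z₁ ≟F i
      ... | yes x∈i | _      = x , x∈i , inj₁ refl
      ... | no _    | yes z₁∈i = z₁ , z₁∈i , inj₂ (inj₁ refl)
      ... | no x∉i  | no z₁∉i  = z₂ , sym (Fin3-third-unique (~-part (proj₁ x~ᴵz₁)) (~-part (proj₁ x~ᴵz₂)) (~-part z₁~z₂)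
                                            (λ i≡x → x∉i (sym i≡x)) (λ i≡z₁ → z₁∉i (sym i≡z₁))) , inj₂ (inj₂ refl)

    opaque
      outside-T : ∀ {u} → ¬ InT u → Leaf u × ∃[ t ] InT t × u ~ t
      outside-T {u} u∉T with part u ≟F part v
      ... | no u≢v = attached leaf v~x (inj₁ refl) u≢v u∉T
      ... | yes u≡v with another-vertex (part x) x
      ...   | p , p∈x , p≢x with attached leaf v~x (inj₁ refl) (λ p≡v → ~-part v~x (trans (sym p≡v) p∈x)) p∉T
        where
        p∉T : ¬ InT p
        p∉T p∈T = p≢x (T-part-injective p∈T (inj₁ refl) p∈x)
      ...     | leaf-p , t , t∈T , p~t = attached leaf-p p~t t∈T (λ u≡p → ~-part v~x (trans (sym u≡v) (trans u≡p p∈x))) u∉T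

    X : Fin 3 → Fin (suc (suc m))
    X i = proj₂ (proj₁ (T-meets-part i))

    τ : Fin 3 → V
    τ i = (i , X i)

    τ∈T : ∀ i → InT (τ i)
    τ∈T i with T-meets-part i
    ... | (j , _) , refl , t∈T = t∈T

    InT⇒τ : ∀ {u} → InT u → u ≡ τ (part u)
    InT⇒τ {u} u∈T = T-part-injective u∈T (τ∈T (part u)) refl

    off-T : ∀ i {w} → w ≢ X i → ¬ InT (i , w)
    off-T i w≢X iw∈T = w≢X (cong proj₂ (InT⇒τ iw∈T))

    same-attachment : ∀ {u u′ t} → ¬ InT u → ¬ InT u′ → u ~ t → u′ ~ t → part u ≡ part u′
    same-attachment {u} {u′} u∉T u′∉T u~t u′~t = decidable-stable (part u ≟F part u′) λ u≢u′ →
      leaf-nbrs-distinct (proj₁ (outside-T u∉T)) (proj₁ (outside-T u′∉T)) u≢u′ u~t u′~t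

    leafOf : Fin 3 → V
    leafOf i = proj₁ (another-vertex i (τ i))

    leafOf∉T : ∀ i → ¬ InT (leafOf i)
    leafOf∉T i l∈T with another-vertex i (τ i)
    ... | l , refl , l≢τ = l≢τ (InT⇒τ l∈T)

    attachmentOf : Fin 3 → V
    attachmentOf i = proj₁ (proj₂ (outside-T (leafOf∉T i)))

    σ : Fin 3 → Fin 3
    σ i = part (attachmentOf i)

    leafOf~attachmentOf : ∀ i → leafOf i ~ attachmentOf i
    leafOf~attachmentOf i = proj₂ (proj₂ (proj₂ (outside-T (leafOf∉T i))))

    attachmentOf≡τσ : ∀ i → attachmentOf i ≡ τ (σ i)
    attachmentOf≡τσ i = InT⇒τ (proj₁ (proj₂ (proj₂ (outside-T (leafOf∉T i)))))

    part-leafOf : ∀ i → part (leafOf i) ≡ i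
    part-leafOf i with another-vertex i (τ i)
    ... | _ , l∈i , _ = l∈i

    σ-injective : ∀ {i j} → σ i ≡ σ j → i ≡ j
    σ-injective {i} {j} σi≡σj =
      trans (sym (part-leafOf i)) (trans (same-attachment (leafOf∉T i) (leafOf∉T j)
        (leafOf~attachmentOf i) (subst (leafOf j ~_) shared (leafOf~attachmentOf j))) (part-leafOf j))
      where
      shared : attachmentOf j ≡ attachmentOf i
      shared = trans (attachmentOf≡τσ j) (trans (cong τ (sym σi≡σj)) (sym (attachmentOf≡τσ i)))

    σ-fixpoint-free : ∀ i → σ i ≢ i
    σ-fixpoint-free i σi≡i = ~-part (leafOf~attachmentOf i) (trans (part-leafOf i) (sym σi≡i))

    -- The leaf of part j with σ j = part t shares its neighbour t with u, so j is the part of u.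
    attachment-part : ∀ {u t} → ¬ InT u → u ~ t → InT t → part t ≡ σ (part u)
    attachment-part {u} {t} u∉T u~t t∈T with Fin3-injective⇒surjective σ-injective (part t)
    ... | j , σj≡t = trans (sym σj≡t) (cong σ j≡u)
      where
      attachmentOf-j≡t : attachmentOf j ≡ t
      attachmentOf-j≡t = trans (attachmentOf≡τσ j) (trans (cong τ σj≡t) (sym (InT⇒τ t∈T)))
      j≡u : j ≡ part u
      j≡u = trans (sym (part-leafOf j))
                  (same-attachment (leafOf∉T j) u∉T (subst (leafOf j ~_) attachmentOf-j≡t (leafOf~attachmentOf j)) u~t)

    pendant-nbr : ∀ i w → w ≢ X i → ∀ y → (i , w) ~ y ⇔ (y ≡ τ (σ i))
    pendant-nbr i w w≢X y with outside-T (off-T i w≢X)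
    ... | leaf-u , t , t∈T , u~t = mk⇔ (λ u~y → trans (leaf-nbr-unique leaf-u u~y u~t) t≡τσ)
                                      (λ { refl → subst ((i , w) ~_) t≡τσ u~t })
      where
      t≡τσ : t ≡ τ (σ i)
      t≡τσ = trans (InT⇒τ t∈T) (cong τ (attachment-part (off-T i w≢X) u~t t∈T))

    in-Ω : InOmega H
    in-Ω = X , σ , Fin3-injective⇒bijective σ-injective , σ-fixpoint-free ,
           (λ i j i≢j → T-adj (τ∈T i) (τ∈T j) (λ τi≡τj → i≢j (cong proj₁ τi≡τj))) , pendant-nbr

  module NoLeaves (no-leaf : ∀ u → ¬ Leaf u) where

    opaque
      other-nbr : ∀ {t z} → t ~ z → ∃[ z′ ] z′ ≢ z × t ~ z′ × (∀ {c} → t ~ c → c ≡ z ⊎ c ≡ z′)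
      other-nbr {t} {z} t~z with other-inner-nbr (no-leaf t) (t~z , no-leaf z)
      ... | z′ , z′≢z , (t~z′ , _) , only = z′ , z′≢z , t~z′ , λ {c} t~c → only (t~c , no-leaf c)

    module OtherNbr {t z} (t~z : t ~ z) where
      other : V
      other = proj₁ (other-nbr t~z)
      other≢ : other ≢ z
      other≢ = proj₁ (proj₂ (other-nbr t~z))
      t~other : t ~ other
      t~other = proj₁ (proj₂ (proj₂ (other-nbr t~z)))
      nbrs : ∀ {c} → t ~ c → c ≡ z ⊎ c ≡ other
      nbrs = proj₂ (proj₂ (proj₂ (other-nbr t~z)))

    x : V
    x = (zero , zero)

    -- Walking from x along a and along b: x a a′ a″ and x b b′ b″.
    module Walks {a b} (x~a : x ~ a) (x~b : x ~ b) (a≢b : a ≢ b) where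
      open OtherNbr (~-sym x~a) using () renaming (other to a′; other≢ to a′≢x; t~other to a~a′; nbrs to a-nbrs)
      open OtherNbr (~-sym x~b) using () renaming (other to b′; other≢ to b′≢x; t~other to b~b′; nbrs to b-nbrs)
      open OtherNbr (~-sym a~a′) using () renaming (other to a″; t~other to a′~a″; nbrs to a′-nbrs)
      open OtherNbr (~-sym b~b′) using () renaming (other to b″; t~other to b′~b″; nbrs to b′-nbrs)

      x-nbrs : ∀ {c} → x ~ c → c ≡ a ⊎ c ≡ b
      x-nbrs {c} x~c = at-most-two-inner-nbrs (no-leaf x) a≢b (x~a , no-leaf a) (x~b , no-leaf b) (x~c , no-leaf c)

      off₀ : ∀ {u} → x ~ u → part u ≢ zero
      off₀ x~u u≡0 = ~-part x~u (sym u≡0)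

      opaque
        cover : ∀ {u} → part u ≢ zero → u ≡ a ⊎ u ≡ b ⊎ u ≡ a″ ⊎ u ≡ b″
        cover {u} u≢0 with adj H x u in x~u
        ... | true with x-nbrs x~u
        ...   | inj₁ u≡a = inj₁ u≡a
        ...   | inj₂ u≡b = inj₂ (inj₁ u≡b)
        cover {u} u≢0 | false with path (λ 0≡u → u≢0 (sym 0≡u)) x~u
        ... | d , c , x~d , d~c , c~u , x≢c , d≢u with x-nbrs x~d
        ...   | inj₁ refl with a-nbrs d~c
        ...     | inj₁ c≡x = ⊥-elim (x≢c (sym c≡x))
        ...     | inj₂ refl with a′-nbrs c~u
        ...       | inj₁ u≡a = ⊥-elim (d≢u (sym u≡a))
        ...       | inj₂ u≡a″ = inj₂ (inj₂ (inj₁ u≡a″))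
        cover {u} u≢0 | false | d , c , x~d , d~c , c~u , x≢c , d≢u | inj₂ refl with b-nbrs d~c
        ...     | inj₁ c≡x = ⊥-elim (x≢c (sym c≡x))
        ...     | inj₂ refl with b′-nbrs c~u
        ...       | inj₁ u≡b = ⊥-elim (d≢u (sym u≡b))
        ...       | inj₂ u≡b″ = inj₂ (inj₂ (inj₂ u≡b″))

      n+n≤4 : suc (suc m) + suc (suc m) ≤ 4
      n+n≤4 = cover-outside-part₀ (a ∷ b ∷ a″ ∷ b″ ∷ []) λ u≢0 → as-∈ (cover u≢0)
        where
        as-∈ : ∀ {u} → u ≡ a ⊎ u ≡ b ⊎ u ≡ a″ ⊎ u ≡ b″ → u ∈ a ∷ b ∷ a″ ∷ b″ ∷ []
        as-∈ (inj₁ e)                 = here e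
        as-∈ (inj₂ (inj₁ e))          = there (here e)
        as-∈ (inj₂ (inj₂ (inj₁ e)))   = there (there (here e))
        as-∈ (inj₂ (inj₂ (inj₂ e)))   = there (there (there (here e)))

      without-a″ : part a″ ≡ zero → ⊥
      without-a″ a″≡0 = three-cover-impossible λ u≢0 → as-∈ u≢0 (cover u≢0)
        where
        as-∈ : ∀ {u} → part u ≢ zero → u ≡ a ⊎ u ≡ b ⊎ u ≡ a″ ⊎ u ≡ b″ → u ∈ a ∷ b ∷ b″ ∷ []
        as-∈ _   (inj₁ e)                 = here e
        as-∈ _   (inj₂ (inj₁ e))          = there (here e)
        as-∈ u≢0 (inj₂ (inj₂ (inj₁ refl))) = ⊥-elim (u≢0 a″≡0)
        as-∈ _   (inj₂ (inj₂ (inj₂ e)))   = there (there (here e))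

      without-b″ : part b″ ≡ zero → ⊥
      without-b″ b″≡0 = three-cover-impossible λ u≢0 → as-∈ u≢0 (cover u≢0)
        where
        as-∈ : ∀ {u} → part u ≢ zero → u ≡ a ⊎ u ≡ b ⊎ u ≡ a″ ⊎ u ≡ b″ → u ∈ a ∷ b ∷ a″ ∷ []
        as-∈ _   (inj₁ e)                 = here e
        as-∈ _   (inj₂ (inj₁ e))          = there (here e)
        as-∈ _   (inj₂ (inj₂ (inj₁ e)))   = there (there (here e))
        as-∈ u≢0 (inj₂ (inj₂ (inj₂ refl))) = ⊥-elim (u≢0 b″≡0)

      -- In a triangle x a b the walk x a a′ a″ returns to x.
      triangle-impossible : a ~ b → ⊥
      triangle-impossible a~b = without-a″ (cong part a″≡x)
        where
        a′≡b : a′ ≡ b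
        a′≡b with a-nbrs a~b
        ... | inj₁ b≡x = ⊥-elim (~-irrefl x~b (sym b≡x))
        ... | inj₂ b≡a′ = sym b≡a′
        a″≡x : a″ ≡ x
        a″≡x with a′-nbrs (subst (_~ x) (sym a′≡b) (~-sym x~b))
        ... | inj₁ x≡a  = ⊥-elim (~-irrefl x~a x≡a)
        ... | inj₂ x≡a″ = sym x≡a″

      module NonTriangle (a≁b : adj H a b ≡ false) where

        a≁ : ∀ {c} → a ~ c → c ≢ b
        a≁ a~c refl = contradiction (trans (sym a~c) a≁b) λ ()

        b≁ : ∀ {c} → b ~ c → c ≢ a
        b≁ b~c refl = contradiction (trans (sym b~c) (trans (SubK3.sym H b a) a≁b)) λ ()

        a′≡b″ : part a′ ≢ zero → a′ ≡ b″
        a′≡b″ a′≢0 with cover a′≢0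
        ... | inj₁ a′≡a                  = ⊥-elim (~-irrefl a~a′ (sym a′≡a))
        ... | inj₂ (inj₁ a′≡b)           = ⊥-elim (a≁ a~a′ a′≡b)
        ... | inj₂ (inj₂ (inj₁ a′≡a″))   = ⊥-elim (~-irrefl a′~a″ a′≡a″)
        ... | inj₂ (inj₂ (inj₂ a′≡b″))   = a′≡b″

        b′≡a″ : part b′ ≢ zero → b′ ≡ a″
        b′≡a″ b′≢0 with cover b′≢0
        ... | inj₁ b′≡a                  = ⊥-elim (b≁ b~b′ b′≡a)
        ... | inj₂ (inj₁ b′≡b)           = ⊥-elim (~-irrefl b~b′ (sym b′≡b))
        ... | inj₂ (inj₂ (inj₁ b′≡a″))   = b′≡a″
        ... | inj₂ (inj₂ (inj₂ b′≡b″))   = ⊥-elim (~-irrefl b′~b″ b′≡b″)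

        a′≡b″⇒b′≡a″ : a′ ≡ b″ → b′ ≡ a″
        a′≡b″⇒b′≡a″ a′≡b″ with a′-nbrs (subst (_~ b′) (sym a′≡b″) (~-sym b′~b″))
        ... | inj₁ b′≡a  = ⊥-elim (b≁ b~b′ b′≡a)
        ... | inj₂ b′≡a″ = b′≡a″

        b′≡a″⇒a′≡b″ : b′ ≡ a″ → a′ ≡ b″
        b′≡a″⇒a′≡b″ b′≡a″ with b′-nbrs (subst (_~ a′) (sym b′≡a″) (~-sym a′~a″))
        ... | inj₁ a′≡b  = ⊥-elim (a≁ a~a′ a′≡b)
        ... | inj₂ a′≡b″ = a′≡b″

        -- x a a′ b′ b is then a 5-cycle whose vertices have all their neighbours on it,
        -- so no vertex of part 0 other than x has a neighbour.
        five-cycle-impossible : part a′ ≢ zero → part b′ ≢ zero → ⊥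
        five-cycle-impossible a′≢0 b′≢0 with another-vertex zero x
        ... | y , y∈0 , y≢x with has-nbr y
        ...   | w , y~w with cover {w} (λ w≡0 → ~-part y~w (trans y∈0 (sym w≡0)))
        ...     | inj₁ refl with a-nbrs (~-sym y~w)
        ...       | inj₁ y≡x  = y≢x y≡x
        ...       | inj₂ y≡a′ = a′≢0 (trans (cong part (sym y≡a′)) y∈0)
        five-cycle-impossible a′≢0 b′≢0 | y , y∈0 , y≢x | w , y~w | inj₂ (inj₁ refl) with b-nbrs (~-sym y~w)
        ...       | inj₁ y≡x  = y≢x y≡x
        ...       | inj₂ y≡b′ = b′≢0 (trans (cong part (sym y≡b′)) y∈0)
        five-cycle-impossible a′≢0 b′≢0 | y , y∈0 , y≢x | w , y~w | inj₂ (inj₂ (inj₁ refl))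
          with b′-nbrs (subst (_~ y) (sym (b′≡a″ b′≢0)) (~-sym y~w))
        ...       | inj₁ y≡b  = off₀ x~b (trans (cong part (sym y≡b)) y∈0)
        ...       | inj₂ y≡b″ = a′≢0 (trans (cong part (trans (a′≡b″ a′≢0) (sym y≡b″))) y∈0)
        five-cycle-impossible a′≢0 b′≢0 | y , y∈0 , y≢x | w , y~w | inj₂ (inj₂ (inj₂ refl))
          with a′-nbrs (subst (_~ y) (sym (a′≡b″ a′≢0)) (~-sym y~w))
        ...       | inj₁ y≡a  = off₀ x~a (trans (cong part (sym y≡a)) y∈0)
        ...       | inj₂ y≡a″ = b′≢0 (trans (cong part (trans (b′≡a″ b′≢0) (sym y≡a″))) y∈0)

        -- a′ = b′ closes the 4-cycle x a a′ b; otherwise part 0 holds x, a′, b′ and n ≥ 3.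
        both-in-part₀-impossible : part a′ ≡ zero → part b′ ≡ zero → ⊥
        both-in-part₀-impossible a′≡0 b′≡0 with a′ ≟V b′
        ... | yes a′≡b′ = C4-free (x , a , a′ , b ,
                ~-irrefl x~a , ≢-sym a′≢x , ~-irrefl x~b , ~-irrefl a~a′ , a≢b , a≁ a~a′ ,
                x~a , a~a′ , ~-sym (subst (b ~_) (sym a′≡b′) b~b′) , ~-sym x~b)
        ... | no a′≢b′ = n≮n 4 (≤-trans (+-mono-≤ 3≤n (s≤s (s≤s z≤n))) n+n≤4)
          where
          3≤n : 3 ≤ suc (suc m)
          3≤n = three-in-part⇒3≤n (sym a′≡0) (sym b′≡0) (≢-sym a′≢x) (≢-sym b′≢x) a′≢b′

      impossible : ⊥
      impossible with adj H a b in a~b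
      ... | true = triangle-impossible a~b
      ... | false with part a′ ≟F zero | part b′ ≟F zero
      ...   | no a′≢0  | no b′≢0  = NonTriangle.five-cycle-impossible a~b a′≢0 b′≢0
      ...   | no a′≢0  | yes b′≡0 =
        without-a″ (trans (cong part (sym (NonTriangle.a′≡b″⇒b′≡a″ a~b (NonTriangle.a′≡b″ a~b a′≢0)))) b′≡0)
      ...   | yes a′≡0 | no b′≢0  =
        without-b″ (trans (cong part (sym (NonTriangle.b′≡a″⇒a′≡b″ a~b (NonTriangle.b′≡a″ a~b b′≢0)))) a′≡0)
      ...   | yes a′≡0 | yes b′≡0 = NonTriangle.both-in-part₀-impossible a~b a′≡0 b′≡0

    no-leaves-impossible : ⊥
    no-leaves-impossible with inner-two-inner-nbrs (no-leaf x)
    ... | a , b , a≢b , (x~a , _) , (x~b , _) = Walks.impossible x~a x~b a≢b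

  extremal-in-Ω : InOmega H
  extremal-in-Ω with any-vertex? leaf?
  ... | no ∄leaf = ⊥-elim (NoLeaves.no-leaves-impossible λ u leaf → ∄leaf (u , leaf))
  ... | yes (v , leaf) with has-nbr v
  ...   | x , v~x with inner-two-inner-nbrs (leaf-nbr-¬leaf leaf v~x)
  ...     | z₁ , z₂ , z₁≢z₂ , x~ᴵz₁ , x~ᴵz₂ = AttachedTriangle.in-Ω leaf v~x x~ᴵz₁ x~ᴵz₂ z₁≢z₂

module InΩ {n : ℕ} (H : SubK3 n) (ω : InOmega H) where
  open Graph H

  X : Fin 3 → Fin n
  X = proj₁ ω

  σ : Fin 3 → Fin 3
  σ = proj₁ (proj₂ ω)

  σ-injective : ∀ {i j} → σ i ≡ σ j → i ≡ j
  σ-injective = proj₁ (proj₁ (proj₂ (proj₂ ω)))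

  σ-fixpoint-free : ∀ i → σ i ≢ i
  σ-fixpoint-free = proj₁ (proj₂ (proj₂ (proj₂ ω)))

  τ : Fin 3 → Vtx n
  τ i = (i , X i)

  τ-adj : ∀ i j → i ≢ j → τ i ~ τ j
  τ-adj = proj₁ (proj₂ (proj₂ (proj₂ (proj₂ ω))))

  InT : Vtx n → Set
  InT u = proj₂ u ≡ X (part u)

  InT? : ∀ u → Dec (InT u)
  InT? u = proj₂ u ≟F X (part u)

  InT⇒τ : ∀ {u} → InT u → u ≡ τ (part u)
  InT⇒τ {i , a} refl = refl

  T-adj : ∀ {u w} → InT u → InT w → part u ≢ part w → u ~ w
  T-adj {i , _} {j , _} refl refl i≢j = τ-adj i j i≢j

  T-part-injective : ∀ {u w} → InT u → InT w → part u ≡ part w → u ≡ w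
  T-part-injective {i , _} {j , _} refl refl refl = refl

  target : Vtx n → Vtx n
  target u = τ (σ (part u))

  outer-nbr : ∀ {u} → ¬ InT u → ∀ w → u ~ w ⇔ (w ≡ target u)
  outer-nbr {i , a} a≢X = proj₂ (proj₂ (proj₂ (proj₂ (proj₂ ω)))) i a a≢X

  outer-nbr-target : ∀ {u w} → ¬ InT u → u ~ w → w ≡ target u
  outer-nbr-target u∉T u~w = Equivalence.to (outer-nbr u∉T _) u~w

  outer~target : ∀ {u} → ¬ InT u → u ~ target u
  outer~target u∉T = Equivalence.from (outer-nbr u∉T _) refl

  two-nbrs⇒InT : ∀ {p q s} → p ~ q → p ~ s → q ≢ s → InT p
  two-nbrs⇒InT {p} p~q p~s q≢s with InT? p
  ... | yes p∈T = p∈T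
  ... | no p∉T  = ⊥-elim (q≢s (trans (outer-nbr-target p∉T p~q) (sym (outer-nbr-target p∉T p~s))))

  -- Every vertex of a 4-cycle has two neighbours on it, so the cycle would need four triangle
  -- vertices, two of them in one part.
  C4-free : ¬ HasC4 (adj H)
  C4-free (p , q , r , s , p≢q , p≢r , p≢s , q≢r , q≢s , r≢s , p~q , q~r , r~s , s~p) =
    four-in-T (two-nbrs⇒InT p~q (~-sym s~p) q≢s) (two-nbrs⇒InT q~r (~-sym p~q) (≢-sym p≢r))
              (two-nbrs⇒InT r~s (~-sym q~r) (≢-sym q≢s)) (two-nbrs⇒InT s~p (~-sym r~s) p≢r)
    where
    four-in-T : InT p → InT q → InT r → InT s → ⊥
    four-in-T p∈T q∈T r∈T s∈T with Fin3-pigeonhole (part p) (part q) (part r) (part s)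
    ... | inj₁ e                               = p≢q (T-part-injective p∈T q∈T e)
    ... | inj₂ (inj₁ e)                        = p≢r (T-part-injective p∈T r∈T e)
    ... | inj₂ (inj₂ (inj₁ e))                 = p≢s (T-part-injective p∈T s∈T e)
    ... | inj₂ (inj₂ (inj₂ (inj₁ e)))          = q≢r (T-part-injective q∈T r∈T e)
    ... | inj₂ (inj₂ (inj₂ (inj₂ (inj₁ e))))   = q≢s (T-part-injective q∈T s∈T e)
    ... | inj₂ (inj₂ (inj₂ (inj₂ (inj₂ e))))   = r≢s (T-part-injective r∈T s∈T e)

  non-adjacent : ∀ {u v} → adj H u v ≡ false → ¬ (v ~ u)
  non-adjacent u≁v v~u = contradiction (trans (sym (~-sym v~u)) u≁v) λ ()

  -- Closing uv through the triangle: u v target(v) τ(part v), resp. u v target(v) target(u).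
  saturates : ∀ u v → part u ≢ part v → adj H u v ≡ false → HasC4 (addEdge (adj H) u v)
  saturates u v u≢v u≁v with InT? u | InT? v
  ... | yes u∈T | yes v∈T = ⊥-elim (non-adjacent u≁v (~-sym (T-adj u∈T v∈T u≢v)))
  ... | yes u∈T | no v∉T =
    u , v , target v , τ (part v) ,
    (λ { refl → u≢v refl }) , (λ { refl → non-adjacent u≁v (outer~target v∉T) }) , (λ { refl → u≢v refl }) ,
    (λ v≡t → σ-fixpoint-free (part v) (cong part (sym v≡t))) , (λ v≡τ → v∉T (subst InT (sym v≡τ) refl)) ,
    (λ t≡τ → σ-fixpoint-free (part v) (cong part t≡τ)) ,
    uv-~⁺ , ~⇒~⁺ (outer~target v∉T) , ~⇒~⁺ (τ-adj _ _ (σ-fixpoint-free (part v))) ,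
    ~⇒~⁺ (T-adj refl u∈T (≢-sym u≢v))
  ... | no u∉T | yes v∈T =
    v , u , target u , τ (part u) ,
    (λ { refl → u≢v refl }) , (λ { refl → non-adjacent u≁v (~-sym (outer~target u∉T)) }) , (λ { refl → u≢v refl }) ,
    (λ u≡t → σ-fixpoint-free (part u) (cong part (sym u≡t))) , (λ u≡τ → u∉T (subst InT (sym u≡τ) refl)) ,
    (λ t≡τ → σ-fixpoint-free (part u) (cong part t≡τ)) ,
    vu-~⁺ , ~⇒~⁺ (outer~target u∉T) , ~⇒~⁺ (τ-adj _ _ (σ-fixpoint-free (part u))) ,
    ~⇒~⁺ (T-adj refl v∈T u≢v)
  ... | no u∉T | no v∉T =
    u , v , target v , target u ,
    (λ { refl → u≢v refl }) , (λ { refl → non-adjacent u≁v (outer~target v∉T) }) ,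
    (λ u≡t → u∉T (subst InT (sym u≡t) refl)) , (λ v≡t → v∉T (subst InT (sym v≡t) refl)) , (λ { refl → non-adjacent u≁v (~-sym (outer~target u∉T)) }) ,
    (λ t≡t → u≢v (σ-injective (sym (cong part t≡t)))) ,
    uv-~⁺ , ~⇒~⁺ (outer~target v∉T) , ~⇒~⁺ (τ-adj _ _ (λ σv≡σu → u≢v (σ-injective (sym σv≡σu)))) ,
    ~⇒~⁺ (~-sym (outer~target u∉T))

  Ω-saturated : C4Saturated H
  Ω-saturated = C4-free , saturates

  outer-nbrs-inner : ∀ {u w} → u ~ w → ¬ InT u → ¬ InT w → ⊥
  outer-nbrs-inner {u} u~w u∉T w∉T = w∉T (subst InT (sym (outer-nbr-target u∉T u~w)) refl)

  open Discharging H (λ u → ¬? (InT? u)) outer-nbrs-inner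

  received-outer : ∀ {u} → ¬ InT u → received u ≡ 2
  received-outer {u} u∉T =
    trans (∑V-supported₁ (charge u) (target u) off-target) (charge-from-L u∉T (outer~target u∉T))
    where
    off-target : ∀ w → w ≢ target u → charge u w ≡ 0
    off-target w w≢t = charge-non-adj (¬~⇒false λ u~w → w≢t (outer-nbr-target u∉T u~w))

  received-inner : ∀ {u} → InT u → received u ≡ 2
  received-inner {u} u∈T =
    trans (∑V-supported₂ (charge u) τj≢τk off-τjk)
          (cong₂ _+_ (charge-inner ¬¬u∈T (T-adj u∈T refl (next-≢ i)) (λ τj∉T → τj∉T refl))
                     (charge-inner ¬¬u∈T (T-adj u∈T refl (next²-≢ i)) (λ τk∉T → τk∉T refl)))
    where
    i = part u
    ¬¬u∈T : ¬ ¬ InT u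
    ¬¬u∈T u∉T = u∉T u∈T
    τj≢τk : τ (next i) ≢ τ (next (next i))
    τj≢τk τj≡τk = next-≢ (next i) (cong part τj≡τk)
    off-τjk : ∀ w → w ≢ τ (next i) → w ≢ τ (next (next i)) → charge u w ≡ 0
    off-τjk w w≢τj w≢τk = by-cases (adj H u w ≟B true) (InT? w)
      where
      by-cases : Dec (u ~ w) → Dec (InT w) → charge u w ≡ 0
      by-cases (no u≁w)  _         = charge-non-adj (¬~⇒false u≁w)
      by-cases (yes _)   (no w∉T)  = charge-to-L ¬¬u∈T w∉T
      by-cases (yes u~w) (yes w∈T) with Fin3-others i (part w) (≢-sym (~-part u~w))
      ... | inj₁ w∈j = ⊥-elim (w≢τj (trans (InT⇒τ w∈T) (cong τ w∈j)))
      ... | inj₂ w∈k = ⊥-elim (w≢τk (trans (InT⇒τ w∈T) (cong τ w∈k)))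

  Ω-edges : edges H ≡ 3 * n
  Ω-edges = received≡2⇒edges≡3n λ u → by-InT u (InT? u)
    where
    by-InT : ∀ u → Dec (InT u) → received u ≡ 2
    by-InT u (yes u∈T) = received-inner u∈T
    by-InT u (no u∉T)  = received-outer u∉T

module Example (m : ℕ) where

  -- The triangle (0,0) (1,0) (2,0) with every other vertex of part i attached to (next i , 0).
  adj₀ : Vtx (suc m) → Vtx (suc m) → Bool
  adj₀ (i , zero)  (j , zero)  = not ⌊ i ≟F j ⌋
  adj₀ (i , suc _) (j , zero)  = ⌊ j ≟F next i ⌋
  adj₀ (i , zero)  (j , suc _) = ⌊ i ≟F next j ⌋
  adj₀ (i , suc _) (j , suc _) = false

  ≟-sym : ∀ (i j : Fin 3) → ⌊ i ≟F j ⌋ ≡ ⌊ j ≟F i ⌋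
  ≟-sym i j with i ≟F j | j ≟F i
  ... | yes _   | yes _   = refl
  ... | no _    | no _    = refl
  ... | yes i≡j | no j≢i  = ⊥-elim (j≢i (sym i≡j))
  ... | no i≢j  | yes j≡i = ⊥-elim (i≢j (sym j≡i))

  adj₀-sym : ∀ u v → adj₀ u v ≡ adj₀ v u
  adj₀-sym (i , zero)  (j , zero)  = cong not (≟-sym i j)
  adj₀-sym (i , suc _) (j , zero)  = refl
  adj₀-sym (i , zero)  (j , suc _) = refl
  adj₀-sym (i , suc _) (j , suc _) = refl

  ⌊≟⌋-true : ∀ {i j : Fin 3} → ⌊ i ≟F j ⌋ ≡ true → i ≡ j
  ⌊≟⌋-true {i} {j} with i ≟F j
  ... | yes i≡j = λ _ → i≡j

  ⌊≟⌋-refl : ∀ (i : Fin 3) → ⌊ i ≟F i ⌋ ≡ true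
  ⌊≟⌋-refl i with i ≟F i
  ... | yes _   = refl
  ... | no i≢i  = ⊥-elim (i≢i refl)

  ⌊≟⌋-irrefl : ∀ (i : Fin 3) → not ⌊ i ≟F i ⌋ ≢ true
  ⌊≟⌋-irrefl i with i ≟F i
  ... | yes _  = λ ()
  ... | no i≢i = ⊥-elim (i≢i refl)

  ⌊≟⌋-false : ∀ {i j : Fin 3} → i ≢ j → not ⌊ i ≟F j ⌋ ≡ true
  ⌊≟⌋-false {i} {j} i≢j with i ≟F j
  ... | yes i≡j = ⊥-elim (i≢j i≡j)
  ... | no _    = refl

  adj₀-parts : ∀ u v → adj₀ u v ≡ true → part u ≢ part v
  adj₀-parts (i , zero)  (j , zero)  u~v refl = ⌊≟⌋-irrefl i u~v
  adj₀-parts (i , suc _) (j , zero)  u~v i≡j = next-≢ i (trans i≡j (⌊≟⌋-true u~v))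
  adj₀-parts (i , zero)  (j , suc _) u~v i≡j = next-≢ j (trans (sym i≡j) (⌊≟⌋-true u~v))

  example : SubK3 (suc m)
  example = record { adj = adj₀ ; sym = adj₀-sym ; inK = adj₀-parts }

  pendant : ∀ i (v : Fin (suc m)) → v ≢ zero → ∀ w → adj₀ (i , v) w ≡ true ⇔ (w ≡ (next i , zero))
  pendant i zero    v≢0 w           = ⊥-elim (v≢0 refl)
  pendant i (suc v) _   (j , zero)  = mk⇔ (λ e → cong (_, zero) (⌊≟⌋-true e)) λ { refl → ⌊≟⌋-refl (next i) }
  pendant i (suc v) _   (j , suc _) = mk⇔ (λ ()) (λ ())

  example-in-Ω : InOmega example
  example-in-Ω = (λ _ → zero) , next , Fin3-injective⇒bijective next-injective , (λ i → ≢-sym (next-≢ i)) ,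
                 (λ i j i≢j → ⌊≟⌋-false i≢j) , pendant

theorem1p5 : ∀ (n : ℕ) → 2 ≤ n →
    ( (∃[ H ] (C4Saturated {n} H × edges H ≡ 3 * n))
    × (∀ (H : SubK3 n) → C4Saturated H → 3 * n ≤ edges H) )
    × (∀ (H : SubK3 n) → (C4Saturated H × edges H ≡ 3 * n) ⇔ InOmega H)
theorem1p5 (suc (suc m)) (s≤s (s≤s z≤n)) =
  ( (example , InΩ.Ω-saturated example example-in-Ω , InΩ.Ω-edges example example-in-Ω)
  , λ H saturated → Saturated.3n≤edges-saturated H saturated )
  , λ H → mk⇔ (λ (saturated , extremal) → Extremal.extremal-in-Ω H saturated extremal)
              (λ ω → InΩ.Ω-saturated H ω , InΩ.Ω-edges H ω)
  where open Example (suc m)
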